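{- Let $\Delta$ be a positive integer and let $\mathcal{S}=\{x\in\mathbb{R}^n: Ax\le b\}$ be a simplex, where the system has the form $\binom{H}{c^\top}x\le\binom{h}{c_0}$, $A=\binom{H}{c^\top}\in\mathbb{Z}^{(n+1)\times n}$, $b=\binom{h}{c_0}\in\mathbb{Z}^{n+1}$, and $\Delta(A)\le\Delta$. Then: (1) If the system satisfies conditions (N1)–(N4) below, then it also satisfies conditions (N5) and (N6); that is, $c\in\mathrm{Par}(-H^\top)$ and $\|A\|_{\max}\le\Delta$. (2) If the system is normalized (satisfies (N1)–(N6)) and $\mathcal{S}$ is an empty simplex or an empty lattice-simplex, then $|c_0-c^\top v|\le\Delta$, where $v=H^{ -1}h$ is the vertex of $\mathcal{S}$ opposite to the facet induced by $c^\top x\le c_0$. The conditions are: (N1) $A$ is in Hermite normal form and $|\det(H)|=\Delta(A)$; (N2) $H=\begin{pmatrix} I_s & 0_{s\times k}\\ B & T\end{pmatrix}$ with $k+s=n$, $k\le\log_2(\Delta)$, the columns of $B$ sorted lexicographically, $T$ lower triangular with $T_{ii}\ge 2$ for all $i\in\{1,\dots,k\}$; (N3) $0\le h_i<H_{ii}$ for all $i\in\{1,\dots,n\}$ (so $h_i=0$ for $i\le s$); (N4) for every inequality $a^\top x\le a_0$ of the system, $\gcd(a,a_0)=1$; (N5) $c\in\mathrm{Par}(-H^\top)$; (N6) $\|A\|_{\max}\le\Delta$.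
   Context: For $M\in\mathbb{Z}^{m\times n}$, $\Delta(M)$ is the maximum absolute value of determinants of all $r\times r$ submatrices of $M$, $r=\operatorname{rank}(M)$; $\|M\|_{\max}=\max_{i,j}|M_{ij}|$. A matrix $H\in\mathbb{Z}^{n\times n}$ is in Hermite normal form (HNF) if it is lower triangular, nonnegative, with $0\le H_{ij}<H_{ii}$ for all $j<i$; an $(n+1)\times n$ matrix $\binom{H}{c^\top}$ is in HNF if $H$ is in HNF (the last row $c^\top$ is arbitrary). For $M\in\mathbb{Z}^{n\times n}$, $\mathrm{Par}(M)=\{Mt: t\in(0,1]^n\}$. A system satisfying (N1)–(N6) is called normalized. A lattice-simplex is a simplex with all vertices in $\mathbb{Z}^n$; it is empty if its only integer points are its vertices; a simplex that is not a lattice-simplex is empty if it contains no integer points. -}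

module Defs where

open import Data.Nat as ℕ using (ℕ; zero; suc)
open import Data.Nat.GCD using (gcd)
open import Data.Nat.Logarithm using (⌊log₂_⌋)
open import Data.Integer as ℤ using (ℤ; +_; ∣_∣)
open import Data.Rational as ℚ using (ℚ; 0ℚ; 1ℚ)
open import Data.Fin as Fin using (Fin; toℕ; punchIn)
open import Data.Product using (Σ; ∃; _×_; _,_)
open import Data.Sum using (_⊎_)
open import Relation.Binary.PropositionalEquality using (_≡_)
open import Relation.Nullary using (¬_)

-- matrices as functions; rows indexed first
Mat : Set → ℕ → ℕ → Set
Mat A m n = Fin m → Fin n → A

sumℤ : ∀ {n} → (Fin n → ℤ) → ℤ
sumℤ {zero}  f = + 0
sumℤ {suc n} f = f Fin.zero ℤ.+ sumℤ (λ i → f (Fin.suc i))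

sumℚ : ∀ {n} → (Fin n → ℚ) → ℚ
sumℚ {zero}  f = 0ℚ
sumℚ {suc n} f = f Fin.zero ℚ.+ sumℚ (λ i → f (Fin.suc i))

maxℕ : ∀ {n} → (Fin n → ℕ) → ℕ
maxℕ {zero}  f = 0
maxℕ {suc n} f = f Fin.zero ℕ.⊔ maxℕ (λ i → f (Fin.suc i))

gcdRow : ∀ {n} → (Fin n → ℤ) → ℤ → ℕ
gcdRow {zero}  a a0 = ∣ a0 ∣
gcdRow {suc n} a a0 = gcd ∣ a Fin.zero ∣ (gcdRow (λ i → a (Fin.suc i)) a0)

toℚ : ℤ → ℚ
toℚ z = z ℚ./ 1

det : ∀ {n} → Mat ℤ n n → ℤ
det {zero}  M = + 1
det {suc n} M =
  sumℤ (λ j → (sgn j ℤ.* M Fin.zero j) ℤ.* det (λ r s → M (Fin.suc r) (punchIn j s)))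
  where
  sgn : Fin (suc n) → ℤ
  sgn j = (ℤ.- (+ 1)) ℤ.^ toℕ j

-- stacking H (n×n) on top of the row cᵀ: A = (H ; cᵀ) ∈ ℤ^{(n+1)×n}
stack : ∀ {n} {X : Set} → (Fin n → X) → X → Fin (suc n) → X
stack {zero}  H c Fin.zero = c
stack {suc n} H c Fin.zero = H Fin.zero
stack {suc n} H c (Fin.suc i) = stack (λ r → H (Fin.suc r)) c i

-- Δ(A) for A ∈ ℤ^{(n+1)×n} of rank n: max |det| of n×n submatrices
-- (an n×n submatrix is obtained by deleting one row)
ΔA : ∀ {n} → Mat ℤ (suc n) n → ℕ
ΔA A = maxℕ (λ i → ∣ det (λ r s → A (punchIn i r) s) ∣)

maxNormLe : ∀ {m n} → Mat ℤ m n → ℕ → Set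
maxNormLe A Δ = ∀ i j → ∣ A i j ∣ ℕ.≤ Δ

IsHNF : ∀ {n} → Mat ℤ n n → Set
IsHNF H = ∀ i j → (toℕ i ℕ.< toℕ j → H i j ≡ + 0)
                × (+ 0 ℤ.≤ H i j)
                × (toℕ j ℕ.< toℕ i → H i j ℤ.< H i i)

-- lexicographic order (non-strict) on columns j, j' of H restricted to rows i with s ≤ i
-- (i.e. the columns of the lower-left block B)
LexLeCol : ∀ {n} → Mat ℤ n n → ℕ → Fin n → Fin n → Set
LexLeCol H s j j' =
    (∀ i → s ℕ.≤ toℕ i → H i j ≡ H i j')
  ⊎ (∃ λ i → s ℕ.≤ toℕ i × H i j ℤ.< H i j'
           × (∀ i' → s ℕ.≤ toℕ i' → toℕ i' ℕ.< toℕ i → H i' j ≡ H i' j'))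

dotℚ : ∀ {n} → (Fin n → ℤ) → (Fin n → ℚ) → ℚ
dotℚ a x = sumℚ (λ j → toℚ (a j) ℚ.* x j)

InS : ∀ {n} → Mat ℤ (suc n) n → (Fin (suc n) → ℤ) → (Fin n → ℚ) → Set
InS A b x = ∀ i → dotℚ (A i) x ℚ.≤ toℚ (b i)

AffIndep : ∀ {n} → (Fin (suc n) → Fin n → ℚ) → Set
AffIndep V = ∀ (λ′ : Fin _ → ℚ) → sumℚ λ′ ≡ 0ℚ
           → (∀ j → sumℚ (λ i → λ′ i ℚ.* V i j) ≡ 0ℚ)
           → ∀ i → λ′ i ≡ 0ℚ

ConvHull : ∀ {n} → (Fin (suc n) → Fin n → ℚ) → (Fin n → ℚ) → Set
ConvHull V x = ∃ λ (λ′ : Fin _ → ℚ) → (∀ i → 0ℚ ℚ.≤ λ′ i) × sumℚ λ′ ≡ 1ℚ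
             × (∀ j → x j ≡ sumℚ (λ i → λ′ i ℚ.* V i j))

SimplexWithVertices : ∀ {n} → Mat ℤ (suc n) n → (Fin (suc n) → ℤ)
                    → (Fin (suc n) → Fin n → ℚ) → Set
SimplexWithVertices A b V =
  AffIndep V × (∀ x → (InS A b x → ConvHull V x) × (ConvHull V x → InS A b x))

IsSimplex : ∀ {n} → Mat ℤ (suc n) n → (Fin (suc n) → ℤ) → Set
IsSimplex A b = ∃ λ V → SimplexWithVertices A b V

IntIn : ∀ {n} → Mat ℤ (suc n) n → (Fin (suc n) → ℤ) → (Fin n → ℤ) → Set
IntIn A b z = InS A b (λ j → toℚ (z j))

-- empty (non-lattice) simplex: no integer points; or empty lattice-simplex:
-- all vertices integral and the only integer points are vertices
EmptyOrEmptyLattice : ∀ {n} → Mat ℤ (suc n) n → (Fin (suc n) → ℤ)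
                    → (Fin (suc n) → Fin n → ℚ) → Set
EmptyOrEmptyLattice A b V =
    (∀ z → ¬ IntIn A b z)
  ⊎ ((∀ i → ∃ λ (z : Fin _ → ℤ) → (λ j → toℚ (z j)) ≡ V i)
     × (∀ z → IntIn A b z → ∃ λ i → (λ j → toℚ (z j)) ≡ V i))

module _ {n : ℕ} (H : Mat ℤ n n) (c : Fin n → ℤ) (h : Fin n → ℤ) (c0 : ℤ) where

  Asys : Mat ℤ (suc n) n
  Asys = stack H c

  bsys : Fin (suc n) → ℤ
  bsys = stack h c0

  N1 : Set
  N1 = IsHNF H × ∣ det H ∣ ≡ ΔA Asys

  -- H = ( I_s 0 ; B T ), k + s = n, k ≤ log₂ Δ, columns of B lex sorted,
  -- T lower triangular with diagonal entries ≥ 2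
  N2 : ℕ → Set
  N2 Δ = ∃ λ s → ∃ λ k → k ℕ.+ s ≡ n × k ℕ.≤ ⌊log₂ Δ ⌋
       × (∀ i j → toℕ i ℕ.< s → H i j ≡ (if⇒ i j))
       × (∀ j j' → toℕ j ℕ.< s → toℕ j' ℕ.< s → toℕ j ℕ.≤ toℕ j' → LexLeCol H s j j')
       × (∀ i j → s ℕ.≤ toℕ i → s ℕ.≤ toℕ j → toℕ i ℕ.< toℕ j → H i j ≡ + 0)
       × (∀ i → s ℕ.≤ toℕ i → + 2 ℤ.≤ H i i)
    where
    if⇒ : Fin n → Fin n → ℤ
    if⇒ i j with toℕ i ℕ.≟ toℕ j
    ... | Relation.Nullary.yes _ = + 1
    ... | Relation.Nullary.no  _ = + 0

  N3 : Set
  N3 = ∀ i → (+ 0 ℤ.≤ h i) × (h i ℤ.< H i i)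

  N4 : Set
  N4 = ∀ i → gcdRow (Asys i) (bsys i) ≡ 1

  -- c ∈ Par(−Hᵀ) = { −Hᵀ t : t ∈ (0,1]ⁿ }
  N5 : Set
  N5 = ∃ λ (t : Fin n → ℚ) → (∀ i → (0ℚ ℚ.< t i) × (t i ℚ.≤ 1ℚ))
     × (∀ j → toℚ (c j) ≡ ℚ.- sumℚ (λ i → toℚ (H i j) ℚ.* t i))

  N6 : ℕ → Set
  N6 Δ = maxNormLe Asys Δ

{-# OPTIONS --safe #-}
-- Solving Hᵀt = −c for the triangular matrix H gives c = −Hᵀt. If some tᵢ ≤ 0, the direction d
-- with Hd = −eᵢ has cᵀd ≤ 0, so a whole ray would lie in the bounded simplex; hence t > 0.
-- Cramer's rule gives ∣tᵢ∣·∣det H∣ = ∣det A₍ᵢ₎∣ ≤ Δ(A) = ∣det H∣ for the submatrix A₍ᵢ₎ without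
-- row i of H, so t ≤ 1, and ∣cⱼ∣ = ∑ᵢ Hᵢⱼtᵢ is at most a column sum of H, which in Hermite
-- normal form is at most ∏ Hᵢᵢ = ∣det H∣ ≤ Δ.
-- For (2), c₀ − cᵀv = c₀ + tᵀh ≥ 0 and tᵀh + 1 ≤ ∑ (Hᵢᵢ − 1) + 1 ≤ ∏ Hᵢᵢ ≤ Δ. A larger gap would
-- force c₀ > 1, putting the origin into the simplex; then the origin (if h ≠ 0) or the integer
-- point −eₗ (if h = 0) is an integer point of the simplex lying strictly inside a segment of the
-- simplex, so it is not a vertex, contradicting emptiness.
module Submission where

open import Defs
open import Data.Nat as ℕ using (ℕ; zero; suc; _≤_)
import Data.Nat.Properties as ℕP
import Data.Nat.Coprimality as Coprime
import Data.Nat.GCD as GCD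
open import Data.Integer as ℤ using (ℤ; +_)
import Data.Integer.Properties as ℤP
open import Data.Integer.Solver using (module +-*-Solver)
open import Data.Rational as ℚ using (ℚ; 0ℚ; 1ℚ; mkℚ)
import Data.Rational.Properties as ℚP
import Data.Rational.Solver as ℚSolver
import Data.Rational.Unnormalised as ℚᵘ
import Data.Rational.Unnormalised.Properties as ℚᵘP
open import Data.Fin as Fin using (Fin; zero; suc; punchIn; punchOut; toℕ; inject₁; fromℕ)
import Data.Fin.Properties as FinP
open import Data.Vec.Functional using (updateAt)
open import Data.Vec.Functional.Properties using (map-updateAt; updateAt-updates; updateAt-minimal)
open import Data.Product using (Σ; ∃; _×_; _,_; proj₁; proj₂)
open import Data.Sum using (_⊎_; inj₁; inj₂)
open import Data.Empty using (⊥; ⊥-elim)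
open import Function using (_∘_; const)
open import Relation.Nullary using (¬_; Dec; yes; no)
open import Relation.Binary using (tri<; tri≈; tri>)
open import Relation.Binary.PropositionalEquality
open import Algebra.Bundles using (CommutativeRing; CommutativeMonoid)
open import Algebra.Properties.AbelianGroup ℚP.+-0-abelianGroup using () renaming (⁻¹-involutive to neg-involutive)
open import Algebra.Properties.CommutativeMonoid.Sum ℕP.+-0-commutativeMonoid using ()
  renaming (sum to ∑ℕ; sum-remove to ∑ℕ-remove)
open import Algebra.Properties.CommutativeMonoid.Sum ℕP.*-1-commutativeMonoid using ()
  renaming (sum to ∏ℕ; sum-remove to ∏ℕ-remove)
open import Algebra.Properties.CommutativeMonoid.Sum ℤP.*-1-commutativeMonoid using ()
  renaming (sum to ∏ℤ)

module FiniteSums {c ℓ} (R : CommutativeRing c ℓ)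
  (σ : ∀ {n} → (Fin n → CommutativeRing.Carrier R) → CommutativeRing.Carrier R)
  (σ-zero : ∀ f → σ {0} f ≡ CommutativeRing.0# R)
  (σ-suc : ∀ {n} f → σ {suc n} f ≡ CommutativeRing._+_ R (f zero) (σ (f ∘ suc)))
  where

  private
    module R = CommutativeRing R
  open R using (Carrier; 0#; _+_; _*_; -_; 1#; _≈_)
  open import Algebra.Properties.Semiring.Sum R.semiring
  open import Algebra.Properties.Ring R.ring using (-1*x≈-x)
  open import Relation.Binary.Reasoning.Setoid R.setoid

  σ≈sum : ∀ {n} (f : Fin n → Carrier) → σ f ≈ sum f
  σ≈sum {zero} f = R.reflexive (σ-zero f)
  σ≈sum {suc n} f = R.trans (R.reflexive (σ-suc f)) (R.+-congˡ (σ≈sum (f ∘ suc)))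

  σ-cong : ∀ {n} {f g : Fin n → Carrier} → (∀ i → f i ≈ g i) → σ f ≈ σ g
  σ-cong {f = f} {g} f≈g = begin
    σ f   ≈⟨ σ≈sum f ⟩
    sum f ≈⟨ sum-cong-≋ f≈g ⟩
    sum g ≈⟨ σ≈sum g ⟨
    σ g   ∎

  σ-distrib-+ : ∀ {n} (f g : Fin n → Carrier) → σ (λ i → f i + g i) ≈ σ f + σ g
  σ-distrib-+ f g = begin
    σ (λ i → f i + g i)   ≈⟨ σ≈sum _ ⟩
    sum (λ i → f i + g i) ≈⟨ ∑-distrib-+ f g ⟩
    sum f + sum g         ≈⟨ R.+-cong (σ≈sum f) (σ≈sum g) ⟨
    σ f + σ g             ∎

  σ-*ˡ : ∀ {n} x (f : Fin n → Carrier) → σ (λ i → x * f i) ≈ x * σ f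
  σ-*ˡ x f = begin
    σ (λ i → x * f i)   ≈⟨ σ≈sum _ ⟩
    sum (λ i → x * f i) ≈⟨ *-distribˡ-sum x f ⟨
    x * sum f           ≈⟨ R.*-congˡ (σ≈sum f) ⟨
    x * σ f             ∎

  σ-neg : ∀ {n} (f : Fin n → Carrier) → σ (λ i → - f i) ≈ - σ f
  σ-neg f = begin
    σ (λ i → - f i)      ≈⟨ σ-cong (λ i → -1*x≈-x (f i)) ⟨
    σ (λ i → - 1# * f i) ≈⟨ σ-*ˡ (- 1#) f ⟩
    - 1# * σ f           ≈⟨ -1*x≈-x (σ f) ⟩
    - σ f                ∎

  σ-zeros : ∀ {n} → σ {n} (λ _ → 0#) ≈ 0#
  σ-zeros {n} = R.trans (σ≈sum _) (sum-replicate-zero n)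

  σ-comm : ∀ {m n} (f : Fin m → Fin n → Carrier) → σ (λ i → σ (f i)) ≈ σ (λ j → σ (λ i → f i j))
  σ-comm f = begin
    σ (λ i → σ (f i))               ≈⟨ R.trans (σ≈sum _) (sum-cong-≋ (λ i → σ≈sum (f i))) ⟩
    sum (λ i → sum (f i))           ≈⟨ ∑-comm f ⟩
    sum (λ j → sum (λ i → f i j))   ≈⟨ R.trans (σ≈sum _) (sum-cong-≋ (λ j → σ≈sum (λ i → f i j))) ⟨
    σ (λ j → σ (λ i → f i j))       ∎

  σ-remove : ∀ {n} (i : Fin (suc n)) (f : Fin (suc n) → Carrier) → σ f ≈ f i + σ (f ∘ punchIn i)
  σ-remove i f = begin
    σ f                     ≈⟨ σ≈sum f ⟩
    sum f                   ≈⟨ sum-remove f ⟩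
    f i + sum (f ∘ punchIn i) ≈⟨ R.+-congˡ (σ≈sum _) ⟨
    f i + σ (f ∘ punchIn i) ∎

  σ-delta : ∀ {n} (i : Fin n) (f : Fin n → Carrier) → (∀ j → j ≢ i → f j ≈ 0#) → σ f ≈ f i
  σ-delta {suc n} i f f≈0 = begin
    σ f                        ≈⟨ σ-remove i f ⟩
    f i + σ (f ∘ punchIn i)    ≈⟨ R.+-congˡ (R.trans (σ-cong (λ k → f≈0 _ (FinP.punchInᵢ≢i i k))) σ-zeros) ⟩
    f i + 0#                   ≈⟨ R.+-identityʳ (f i) ⟩
    f i                        ∎

module Σℤ = FiniteSums ℤP.+-*-commutativeRing sumℤ (λ _ → refl) (λ _ → refl)
module Σℚ = FiniteSums ℚP.+-*-commutativeRing sumℚ (λ _ → refl) (λ _ → refl)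

sumℚ-mono-≤ : ∀ {n} {f g : Fin n → ℚ} → (∀ i → f i ℚ.≤ g i) → sumℚ f ℚ.≤ sumℚ g
sumℚ-mono-≤ {zero} f≤g = ℚP.≤-refl
sumℚ-mono-≤ {suc n} f≤g = ℚP.+-mono-≤ (f≤g zero) (sumℚ-mono-≤ (f≤g ∘ suc))

sumℚ-nonNeg : ∀ {n} {f : Fin n → ℚ} → (∀ i → 0ℚ ℚ.≤ f i) → 0ℚ ℚ.≤ sumℚ f
sumℚ-nonNeg {n} {f} 0≤f = subst (ℚ._≤ sumℚ f) (Σℚ.σ-zeros {n}) (sumℚ-mono-≤ 0≤f)

term≤sumℚ : ∀ {n} {f : Fin n → ℚ} → (∀ i → 0ℚ ℚ.≤ f i) → ∀ i → f i ℚ.≤ sumℚ f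
term≤sumℚ {suc n} {f} 0≤f i = begin
  f i                         ≡⟨ ℚP.+-identityʳ (f i) ⟨
  f i ℚ.+ 0ℚ                  ≤⟨ ℚP.+-monoʳ-≤ (f i) (sumℚ-nonNeg (0≤f ∘ punchIn i)) ⟩
  f i ℚ.+ sumℚ (f ∘ punchIn i) ≡⟨ Σℚ.σ-remove i f ⟨
  sumℚ f                      ∎
  where open ℚP.≤-Reasoning

∣sumℚ∣≤sumℚ∣∣ : ∀ {n} (f : Fin n → ℚ) → ℚ.∣ sumℚ f ∣ ℚ.≤ sumℚ (ℚ.∣_∣ ∘ f)
∣sumℚ∣≤sumℚ∣∣ {zero} f = ℚP.≤-refl
∣sumℚ∣≤sumℚ∣∣ {suc n} f =
  ℚP.≤-trans (ℚP.∣p+q∣≤∣p∣+∣q∣ (f zero) _) (ℚP.+-monoʳ-≤ ℚ.∣ f zero ∣ (∣sumℚ∣≤sumℚ∣∣ (f ∘ suc)))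

∑ℕ-mono-≤ : ∀ {n} {f g : Fin n → ℕ} → (∀ i → f i ℕ.≤ g i) → ∑ℕ f ℕ.≤ ∑ℕ g
∑ℕ-mono-≤ {zero} f≤g = ℕ.z≤n
∑ℕ-mono-≤ {suc n} f≤g = ℕP.+-mono-≤ (f≤g zero) (∑ℕ-mono-≤ (f≤g ∘ suc))

∏ℕ-positive : ∀ {n} (a : Fin n → ℕ) → (∀ i → 1 ℕ.≤ a i) → 1 ℕ.≤ ∏ℕ a
∏ℕ-positive {zero} a 1≤a = ℕP.≤-refl
∏ℕ-positive {suc n} a 1≤a = ℕP.*-mono-≤ (1≤a zero) (∏ℕ-positive (a ∘ suc) (1≤a ∘ suc))

factor≤∏ℕ : ∀ {n} (a : Fin n → ℕ) → (∀ i → 1 ℕ.≤ a i) → ∀ i → a i ℕ.≤ ∏ℕ a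
factor≤∏ℕ {suc n} a 1≤a i = begin
  a i                           ≡⟨ ℕP.*-identityʳ (a i) ⟨
  a i ℕ.* 1                     ≤⟨ ℕP.*-monoʳ-≤ (a i) (∏ℕ-positive (a ∘ punchIn i) (1≤a ∘ punchIn i)) ⟩
  a i ℕ.* ∏ℕ (a ∘ punchIn i)    ≡⟨ ∏ℕ-remove a ⟨
  ∏ℕ a                          ∎
  where open ℕP.≤-Reasoning

∑pred+1≤∏ℕ : ∀ {n} (a : Fin n → ℕ) → (∀ i → 1 ℕ.≤ a i) → ∑ℕ (λ i → a i ℕ.∸ 1) ℕ.+ 1 ℕ.≤ ∏ℕ a
∑pred+1≤∏ℕ {zero} a 1≤a = ℕP.≤-refl
∑pred+1≤∏ℕ {suc n} a 1≤a = begin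
  (x ℕ.+ S) ℕ.+ 1    ≡⟨ ℕP.+-assoc x S 1 ⟩
  x ℕ.+ (S ℕ.+ 1)    ≤⟨ ℕP.+-mono-≤ (ℕP.m≤m*n x P) IH ⟩
  x ℕ.* P ℕ.+ P      ≡⟨ cong (x ℕ.* P ℕ.+_) (ℕP.*-identityˡ P) ⟨
  x ℕ.* P ℕ.+ 1 ℕ.* P ≡⟨ ℕP.*-distribʳ-+ P x 1 ⟨
  (x ℕ.+ 1) ℕ.* P    ≡⟨ cong (ℕ._* P) (ℕP.m∸n+n≡m (1≤a zero)) ⟩
  a zero ℕ.* P       ∎
  where
  open ℕP.≤-Reasoning
  x S P : ℕ
  x = a zero ℕ.∸ 1
  S = ∑ℕ (λ i → a (suc i) ℕ.∸ 1)
  P = ∏ℕ (a ∘ suc)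
  IH : S ℕ.+ 1 ℕ.≤ P
  IH = ∑pred+1≤∏ℕ (a ∘ suc) (1≤a ∘ suc)
  instance
    P≢0 : ℕ.NonZero P
    P≢0 = ℕ.>-nonZero (ℕP.≤-trans (ℕP.m≤n+m 1 S) IH)

∑ℕ≤∏ℕ : ∀ {n} (a b : Fin n → ℕ) (j : Fin n) → (∀ i → 1 ℕ.≤ a i) → b j ℕ.≤ a j →
  (∀ i → i ≢ j → b i ℕ.< a i) → ∑ℕ b ℕ.≤ ∏ℕ a
∑ℕ≤∏ℕ {suc n} a b j 1≤a bj≤aj b<a = begin
  ∑ℕ b                                                  ≡⟨ ∑ℕ-remove b ⟩
  b j ℕ.+ ∑ℕ (b ∘ punchIn j)                            ≤⟨ ℕP.+-mono-≤ bj≤aj (∑ℕ-mono-≤ (λ k →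
                                                             ℕP.∸-monoˡ-≤ 1 (b<a (punchIn j k) (FinP.punchInᵢ≢i j k)))) ⟩
  a j ℕ.+ S′                                            ≡⟨ cong (ℕ._+ S′) (ℕP.m∸n+n≡m (1≤a j)) ⟨
  (a j ℕ.∸ 1) ℕ.+ 1 ℕ.+ S′                              ≡⟨ xy∙z≈xz∙y (a j ℕ.∸ 1) 1 S′ ⟩
  (a j ℕ.∸ 1) ℕ.+ S′ ℕ.+ 1                              ≡⟨ cong (ℕ._+ 1) (∑ℕ-remove (λ i → a i ℕ.∸ 1)) ⟨
  ∑ℕ (λ i → a i ℕ.∸ 1) ℕ.+ 1                            ≤⟨ ∑pred+1≤∏ℕ a 1≤a ⟩
  ∏ℕ a                                                  ∎
  where
  open ℕP.≤-Reasoning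
  open import Algebra.Properties.CommutativeSemigroup ℕP.+-commutativeSemigroup using (xy∙z≈xz∙y)
  S′ : ℕ
  S′ = ∑ℕ (λ k → a (punchIn j k) ℕ.∸ 1)

∣∏ℤ∣≡∏ℕ∣∣ : ∀ {n} (f : Fin n → ℤ) → ℤ.∣ ∏ℤ f ∣ ≡ ∏ℕ (λ i → ℤ.∣ f i ∣)
∣∏ℤ∣≡∏ℕ∣∣ {zero} f = refl
∣∏ℤ∣≡∏ℕ∣∣ {suc n} f = trans (ℤP.abs-* (f zero) _) (cong (ℤ.∣ f zero ∣ ℕ.*_) (∣∏ℤ∣≡∏ℕ∣∣ (f ∘ suc)))

sumℤ-nonNeg≡+∑ℕ∣∣ : ∀ {n} (f : Fin n → ℤ) → (∀ i → + 0 ℤ.≤ f i) → sumℤ f ≡ + ∑ℕ (λ i → ℤ.∣ f i ∣)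
sumℤ-nonNeg≡+∑ℕ∣∣ {zero} f 0≤f = refl
sumℤ-nonNeg≡+∑ℕ∣∣ {suc n} f 0≤f =
  trans (cong₂ ℤ._+_ (sym (ℤP.0≤i⇒+∣i∣≡i (0≤f zero))) (sumℤ-nonNeg≡+∑ℕ∣∣ (f ∘ suc) (0≤f ∘ suc)))
        (sym (ℤP.pos-+ ℤ.∣ f zero ∣ _))

maxℕ-ub : ∀ {n} (f : Fin n → ℕ) i → f i ℕ.≤ maxℕ f
maxℕ-ub f zero = ℕP.m≤m⊔n _ _
maxℕ-ub f (suc i) = ℕP.≤-trans (maxℕ-ub (f ∘ suc) i) (ℕP.m≤n⊔m _ _)

-- Integers inside the rationals

private
  ι : ℤ → ℚ
  ι z = mkℚ z 0 (Coprime.sym (Coprime.1-coprimeTo _))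

  toℚ≡ι : ∀ z → toℚ z ≡ ι z
  toℚ≡ι z = ℚP.↥p/↧p≡p (ι z)

toℚ-+ : ∀ a b → toℚ (a ℤ.+ b) ≡ toℚ a ℚ.+ toℚ b
toℚ-+ a b rewrite toℚ≡ι (a ℤ.+ b) | toℚ≡ι a | toℚ≡ι b =
  ℚP.toℚᵘ-injective (ℚᵘP.≃-trans (ℚᵘ.*≡* (eq a b)) (ℚᵘP.≃-sym (ℚP.toℚᵘ-homo-+ (ι a) (ι b))))
  where
  open +-*-Solver
  eq : ∀ a b → (a ℤ.+ b) ℤ.* + 1 ≡ (a ℤ.* + 1 ℤ.+ b ℤ.* + 1) ℤ.* + 1
  eq = solve 2 (λ a b → (a :+ b) :* con (+ 1) := (a :* con (+ 1) :+ b :* con (+ 1)) :* con (+ 1)) refl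

toℚ-* : ∀ a b → toℚ (a ℤ.* b) ≡ toℚ a ℚ.* toℚ b
toℚ-* a b rewrite toℚ≡ι (a ℤ.* b) | toℚ≡ι a | toℚ≡ι b =
  ℚP.toℚᵘ-injective (ℚᵘP.≃-trans (ℚᵘ.*≡* refl) (ℚᵘP.≃-sym (ℚP.toℚᵘ-homo-* (ι a) (ι b))))

toℚ-neg : ∀ a → toℚ (ℤ.- a) ≡ ℚ.- toℚ a
toℚ-neg a rewrite toℚ≡ι (ℤ.- a) | toℚ≡ι a =
  ℚP.toℚᵘ-injective (ℚᵘP.≃-trans (ℚᵘ.*≡* refl) (ℚᵘP.≃-sym (ℚP.toℚᵘ-homo‿- (ι a))))

toℚ-injective : ∀ {a b} → toℚ a ≡ toℚ b → a ≡ b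
toℚ-injective {a} {b} eq rewrite toℚ≡ι a | toℚ≡ι b = cong ℚ.↥_ eq

toℚ-mono-≤ : ∀ {a b} → a ℤ.≤ b → toℚ a ℚ.≤ toℚ b
toℚ-mono-≤ {a} {b} a≤b rewrite toℚ≡ι a | toℚ≡ι b =
  ℚ.*≤* (subst₂ ℤ._≤_ (sym (ℤP.*-identityʳ a)) (sym (ℤP.*-identityʳ b)) a≤b)

toℚ-cancel-≤ : ∀ {a b} → toℚ a ℚ.≤ toℚ b → a ℤ.≤ b
toℚ-cancel-≤ {a} {b} le rewrite toℚ≡ι a | toℚ≡ι b with le
... | ℚ.*≤* a≤b = subst₂ ℤ._≤_ (ℤP.*-identityʳ a) (ℤP.*-identityʳ b) a≤b

toℚ-mono-< : ∀ {a b} → a ℤ.< b → toℚ a ℚ.< toℚ b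
toℚ-mono-< {a} {b} a<b rewrite toℚ≡ι a | toℚ≡ι b =
  ℚ.*<* (subst₂ ℤ._<_ (sym (ℤP.*-identityʳ a)) (sym (ℤP.*-identityʳ b)) a<b)

toℚ-cancel-< : ∀ {a b} → toℚ a ℚ.< toℚ b → a ℤ.< b
toℚ-cancel-< {a} {b} lt rewrite toℚ≡ι a | toℚ≡ι b with lt
... | ℚ.*<* a<b = subst₂ ℤ._<_ (ℤP.*-identityʳ a) (ℤP.*-identityʳ b) a<b

toℚ-sumℤ : ∀ {n} (f : Fin n → ℤ) → toℚ (sumℤ f) ≡ sumℚ (toℚ ∘ f)
toℚ-sumℤ {zero} f = refl
toℚ-sumℤ {suc n} f = trans (toℚ-+ (f zero) _) (cong (toℚ (f zero) ℚ.+_) (toℚ-sumℤ (f ∘ suc)))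

p*↧p≡↥p : ∀ p → p ℚ.* toℚ (ℚ.↧ p) ≡ toℚ (ℚ.↥ p)
p*↧p≡↥p p@(mkℚ n d _) rewrite toℚ≡ι (ℚ.↧ p) | toℚ≡ι (ℚ.↥ p) =
  ℚP.toℚᵘ-injective (ℚᵘP.≃-trans (ℚP.toℚᵘ-homo-* p (ι (ℚ.↧ p)))
    (ℚᵘ.*≡* (trans (ℤP.*-identityʳ _) (cong (n ℤ.*_) (cong +_ (sym (ℕP.*-identityʳ (suc d))))))))

∣toℚ∣ : ∀ z → ℚ.∣ toℚ z ∣ ≡ toℚ (+ ℤ.∣ z ∣)
∣toℚ∣ z rewrite toℚ≡ι z | toℚ≡ι (+ ℤ.∣ z ∣) = refl

i≤+∣i∣ : ∀ i → i ℤ.≤ + ℤ.∣ i ∣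
i≤+∣i∣ (+ _) = ℤP.≤-refl
i≤+∣i∣ ℤ.-[1+ _ ] = ℤ.-≤+

0≤x≤+n⇒∣x∣≤n : ∀ {x n} → + 0 ℤ.≤ x → x ℤ.≤ + n → ℤ.∣ x ∣ ℕ.≤ n
0≤x≤+n⇒∣x∣≤n {+ _} _ (ℤ.+≤+ m≤n) = m≤n

p≤∣p∣ : ∀ p → p ℚ.≤ ℚ.∣ p ∣
p≤∣p∣ p with ℚP.≤-total 0ℚ p
... | inj₁ 0≤p = ℚP.≤-reflexive (sym (ℚP.0≤p⇒∣p∣≡p 0≤p))
... | inj₂ p≤0 = ℚP.≤-trans p≤0 (ℚP.0≤∣p∣ p)

x+nonPos≤x : ∀ {x y} → y ℚ.≤ 0ℚ → x ℚ.+ y ℚ.≤ x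
x+nonPos≤x {x} {y} y≤0 = subst (x ℚ.+ y ℚ.≤_) (ℚP.+-identityʳ x) (ℚP.+-monoʳ-≤ x y≤0)

0≤x*y : ∀ {x y} → 0ℚ ℚ.≤ x → 0ℚ ℚ.≤ y → 0ℚ ℚ.≤ x ℚ.* y
0≤x*y {x} {y} 0≤x 0≤y = subst (ℚ._≤ x ℚ.* y) (ℚP.*-zeroʳ x) (ℚP.*-monoˡ-≤-nonNeg x {{ℚ.nonNegative 0≤x}} 0≤y)

nonNeg*nonPos≤0 : ∀ {x y} → 0ℚ ℚ.≤ x → y ℚ.≤ 0ℚ → x ℚ.* y ℚ.≤ 0ℚ
nonNeg*nonPos≤0 {x} {y} 0≤x y≤0 = subst (x ℚ.* y ℚ.≤_) (ℚP.*-zeroʳ x) (ℚP.*-monoˡ-≤-nonNeg x {{ℚ.nonNegative 0≤x}} y≤0)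

+-cancelʳ-< : ∀ x {p q} → p ℚ.+ x ℚ.< q ℚ.+ x → p ℚ.< q
+-cancelʳ-< x {p} {q} p+x<q+x = subst₂ ℚ._<_ (x+y-y≡x p x) (x+y-y≡x q x) (ℚP.+-monoˡ-< (ℚ.- x) p+x<q+x)
  where
  open ℚSolver.+-*-Solver
  x+y-y≡x : ∀ x y → (x ℚ.+ y) ℚ.- y ≡ x
  x+y-y≡x = solve 2 (λ x y → (x :+ y) :- y := x) refl

p<p+1 : ∀ p → p ℚ.< p ℚ.+ 1ℚ
p<p+1 p = subst (ℚ._< p ℚ.+ 1ℚ) (ℚP.+-identityʳ p) (ℚP.+-monoʳ-< p (ℚP.positive⁻¹ 1ℚ))

∣p∣-positive : ∀ {p} → p ≢ 0ℚ → ℚ.Positive ℚ.∣ p ∣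
∣p∣-positive {p} p≢0 with ℚP.<-cmp 0ℚ ℚ.∣ p ∣
... | tri< 0<∣p∣ _ _ = ℚ.positive 0<∣p∣
... | tri≈ _ 0≡∣p∣ _ = ⊥-elim (p≢0 (ℚP.∣p∣≡0⇒p≡0 p (sym 0≡∣p∣)))
... | tri> _ _ ∣p∣<0 = ⊥-elim (ℚP.<-irrefl refl (ℚP.<-≤-trans ∣p∣<0 (ℚP.0≤∣p∣ p)))

-- Determinants

sgn : ℕ → ℤ
sgn k = (ℤ.- (+ 1)) ℤ.^ k

minor : ∀ {n} → Mat ℤ (suc n) (suc n) → Fin (suc n) → Mat ℤ n n
minor M j r s = M (suc r) (punchIn j s)

det-cong : ∀ {n} {M N : Mat ℤ n n} → (∀ r s → M r s ≡ N r s) → det M ≡ det N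
det-cong {zero} M≡N = refl
det-cong {suc n} M≡N = Σℤ.σ-cong λ j →
  cong₂ ℤ._*_ (cong (sgn (toℕ j) ℤ.*_) (M≡N zero j)) (det-cong (λ r s → M≡N (suc r) (punchIn j s)))

det-row-linear : ∀ {n} (M : Mat ℤ n n) (r : Fin n) {m} (a : Fin m → ℤ) (X : Fin m → Fin n → ℤ) →
  (∀ s → M r s ≡ sumℤ (λ k → a k ℤ.* X k s)) →
  det M ≡ sumℤ (λ k → a k ℤ.* det (updateAt M r (const (X k))))
det-row-linear {suc n} M zero a X Mr≡ = begin
    sumℤ (λ j → (sgn (toℕ j) ℤ.* M zero j) ℤ.* det (minor M j))
  ≡⟨ Σℤ.σ-cong (λ j → cong (λ x → (sgn (toℕ j) ℤ.* x) ℤ.* det (minor M j)) (Mr≡ j)) ⟩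
    sumℤ (λ j → (sgn (toℕ j) ℤ.* sumℤ (λ k → a k ℤ.* X k j)) ℤ.* det (minor M j))
  ≡⟨ Σℤ.σ-cong (λ j → expand (sgn (toℕ j)) (λ k → a k ℤ.* X k j) (det (minor M j))) ⟩
    sumℤ (λ j → sumℤ (λ k → (sgn (toℕ j) ℤ.* (a k ℤ.* X k j)) ℤ.* det (minor M j)))
  ≡⟨ Σℤ.σ-comm (λ j k → (sgn (toℕ j) ℤ.* (a k ℤ.* X k j)) ℤ.* det (minor M j)) ⟩
    sumℤ (λ k → sumℤ (λ j → (sgn (toℕ j) ℤ.* (a k ℤ.* X k j)) ℤ.* det (minor M j)))
  ≡⟨ Σℤ.σ-cong (λ k → trans (Σℤ.σ-cong (λ j → reorder (sgn (toℕ j)) (a k) (X k j) (det (minor M j))))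
                            (Σℤ.σ-*ˡ (a k) (λ j → (sgn (toℕ j) ℤ.* X k j) ℤ.* det (minor M j)))) ⟩
    sumℤ (λ k → a k ℤ.* det (updateAt M zero (const (X k))))
  ∎
  where
  open ≡-Reasoning
  open +-*-Solver
  reorder : ∀ s a x d → (s ℤ.* (a ℤ.* x)) ℤ.* d ≡ a ℤ.* ((s ℤ.* x) ℤ.* d)
  reorder = solve 4 (λ s a x d → (s :* (a :* x)) :* d := a :* ((s :* x) :* d)) refl
  expand : ∀ {m} s (y : Fin m → ℤ) d → (s ℤ.* sumℤ y) ℤ.* d ≡ sumℤ (λ k → (s ℤ.* y k) ℤ.* d)
  expand s y d = begin
    (s ℤ.* sumℤ y) ℤ.* d              ≡⟨ ℤP.*-comm _ d ⟩
    d ℤ.* (s ℤ.* sumℤ y)              ≡⟨ cong (d ℤ.*_) (Σℤ.σ-*ˡ s y) ⟨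
    d ℤ.* sumℤ (λ k → s ℤ.* y k)      ≡⟨ Σℤ.σ-*ˡ d (λ k → s ℤ.* y k) ⟨
    sumℤ (λ k → d ℤ.* (s ℤ.* y k))    ≡⟨ Σℤ.σ-cong (λ k → ℤP.*-comm d (s ℤ.* y k)) ⟩
    sumℤ (λ k → (s ℤ.* y k) ℤ.* d)    ∎
det-row-linear {suc n} M (suc r) {m} a X Mr≡ = begin
    sumℤ (λ j → s j ℤ.* det (minor M j))
  ≡⟨ Σℤ.σ-cong (λ j → cong (s j ℤ.*_) (minor-linear j)) ⟩
    sumℤ (λ j → s j ℤ.* sumℤ (λ k → a k ℤ.* D k j))
  ≡⟨ Σℤ.σ-cong (λ j → trans (Σℤ.σ-cong (λ k → swap-factors (a k) (s j) (D k j))) (Σℤ.σ-*ˡ (s j) (λ k → a k ℤ.* D k j))) ⟨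
    sumℤ (λ j → sumℤ (λ k → a k ℤ.* (s j ℤ.* D k j)))
  ≡⟨ Σℤ.σ-comm (λ j k → a k ℤ.* (s j ℤ.* D k j)) ⟩
    sumℤ (λ k → sumℤ (λ j → a k ℤ.* (s j ℤ.* D k j)))
  ≡⟨ Σℤ.σ-cong (λ k → Σℤ.σ-*ˡ (a k) (λ j → s j ℤ.* D k j)) ⟩
    sumℤ (λ k → a k ℤ.* det (updateAt M (suc r) (const (X k))))
  ∎
  where
  open ≡-Reasoning
  s : Fin (suc n) → ℤ
  s j = sgn (toℕ j) ℤ.* M zero j
  D : Fin m → Fin (suc n) → ℤ
  D k j = det (minor (updateAt M (suc r) (const (X k))) j)
  swap-factors : ∀ x y z → x ℤ.* (y ℤ.* z) ≡ y ℤ.* (x ℤ.* z)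
  swap-factors x y z = trans (sym (ℤP.*-assoc x y z)) (trans (cong (ℤ._* z) (ℤP.*-comm x y)) (ℤP.*-assoc y x z))
  minor-linear : ∀ j → det (minor M j) ≡ sumℤ (λ k → a k ℤ.* D k j)
  minor-linear j =
    trans (det-row-linear (minor M j) r a (λ k → X k ∘ punchIn j) (Mr≡ ∘ punchIn j))
          (Σℤ.σ-cong (λ k → cong (a k ℤ.*_) (det-cong (λ r′ s′ →
            sym (cong-app (map-updateAt {f = _∘ punchIn j} (λ _ → refl) (M ∘ suc) r r′) s′)))))

swapAdjacent : ∀ {n} {R : Set} → (Fin (suc n) → R) → Fin n → Fin (suc n) → R
swapAdjacent f zero zero = f (suc zero)
swapAdjacent f zero (suc zero) = f zero
swapAdjacent f zero (suc (suc i)) = f (suc (suc i))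
swapAdjacent f (suc r) zero = f zero
swapAdjacent f (suc r) (suc i) = swapAdjacent (f ∘ suc) r i

swapAdjacent-∘ : ∀ {n} {R R′ : Set} (g : R → R′) (f : Fin (suc n) → R) r i →
  swapAdjacent (g ∘ f) r i ≡ g (swapAdjacent f r i)
swapAdjacent-∘ g f zero zero = refl
swapAdjacent-∘ g f zero (suc zero) = refl
swapAdjacent-∘ g f zero (suc (suc i)) = refl
swapAdjacent-∘ g f (suc r) zero = refl
swapAdjacent-∘ g f (suc r) (suc i) = swapAdjacent-∘ g (f ∘ suc) r i

punchIn-punchOut-comm : ∀ {n} {a b : Fin (suc (suc n))} (a≢b : a ≢ b) (b≢a : b ≢ a) (s : Fin n) →
  punchIn a (punchIn (punchOut a≢b) s) ≡ punchIn b (punchIn (punchOut b≢a) s)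
punchIn-punchOut-comm {n} {zero} {zero} a≢b b≢a s = ⊥-elim (a≢b refl)
punchIn-punchOut-comm {n} {zero} {suc b} a≢b b≢a s = refl
punchIn-punchOut-comm {n} {suc a} {zero} a≢b b≢a s = refl
punchIn-punchOut-comm {suc n} {suc a} {suc b} a≢b b≢a zero = refl
punchIn-punchOut-comm {suc n} {suc a} {suc b} a≢b b≢a (suc s) =
  cong suc (punchIn-punchOut-comm (a≢b ∘ cong suc) (b≢a ∘ cong suc) s)

sgn-punchOut-antisym : ∀ {n} {a b : Fin (suc n)} (a≢b : a ≢ b) (b≢a : b ≢ a) →
  sgn (toℕ a) ℤ.* sgn (toℕ (punchOut a≢b)) ≡ ℤ.- (sgn (toℕ b) ℤ.* sgn (toℕ (punchOut b≢a)))
sgn-punchOut-antisym {n} {zero} {zero} a≢b b≢a = ⊥-elim (a≢b refl)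
sgn-punchOut-antisym {suc n} {zero} {suc b} a≢b b≢a =
  solve 1 (λ x → con (+ 1) :* x := :- ((:- con (+ 1) :* x) :* con (+ 1))) refl (sgn (toℕ b))
  where open +-*-Solver
sgn-punchOut-antisym {suc n} {suc a} {zero} a≢b b≢a =
  solve 1 (λ x → (:- con (+ 1) :* x) :* con (+ 1) := :- (con (+ 1) :* x)) refl (sgn (toℕ a))
  where open +-*-Solver
sgn-punchOut-antisym {suc n} {suc a} {suc b} a≢b b≢a = begin
    (ℤ.-1ℤ ℤ.* sgn (toℕ a)) ℤ.* (ℤ.-1ℤ ℤ.* sgn (toℕ (punchOut a≢b′)))
  ≡⟨ drop-signs (sgn (toℕ a)) _ ⟩
    sgn (toℕ a) ℤ.* sgn (toℕ (punchOut a≢b′))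
  ≡⟨ sgn-punchOut-antisym a≢b′ b≢a′ ⟩
    ℤ.- (sgn (toℕ b) ℤ.* sgn (toℕ (punchOut b≢a′)))
  ≡⟨ cong ℤ.-_ (drop-signs (sgn (toℕ b)) _) ⟨
    ℤ.- ((ℤ.-1ℤ ℤ.* sgn (toℕ b)) ℤ.* (ℤ.-1ℤ ℤ.* sgn (toℕ (punchOut b≢a′))))
  ∎
  where
  open ≡-Reasoning
  open +-*-Solver
  a≢b′ : a ≢ b
  a≢b′ = a≢b ∘ cong suc
  b≢a′ : b ≢ a
  b≢a′ = b≢a ∘ cong suc
  drop-signs : ∀ x y → (ℤ.-1ℤ ℤ.* x) ℤ.* (ℤ.-1ℤ ℤ.* y) ≡ x ℤ.* y
  drop-signs = solve 2 (λ x y → (:- con (+ 1) :* x) :* (:- con (+ 1) :* y) := x :* y) refl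

-- Expanding det M along its first two rows gives a double sum of terms indexed by the
-- two columns used; exchanging the two rows turns term a b into − term b a.
module TwoRowExpansion {n : ℕ} (M : Mat ℤ (suc (suc n)) (suc (suc n))) where

  rest : (a b : Fin (suc (suc n))) → a ≢ b → ℤ
  rest a b a≢b = det (λ r s → M (suc (suc r)) (punchIn a (punchIn (punchOut a≢b) s)))

  term′ : (a b : Fin (suc (suc n))) → Dec (a ≡ b) → ℤ
  term′ a b (yes _) = + 0
  term′ a b (no a≢b) =
    ((sgn (toℕ a) ℤ.* sgn (toℕ (punchOut a≢b))) ℤ.* (M zero a ℤ.* M (suc zero) b)) ℤ.* rest a b a≢b

  term : (a b : Fin (suc (suc n))) → ℤ
  term a b = term′ a b (a Fin.≟ b)

  term-diagonal : ∀ a → term a a ≡ + 0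
  term-diagonal a with a Fin.≟ a
  ... | yes _ = refl
  ... | no a≢a = ⊥-elim (a≢a refl)

  term-punchIn : ∀ a k → term a (punchIn a k) ≡
    (sgn (toℕ a) ℤ.* M zero a) ℤ.* ((sgn (toℕ k) ℤ.* M (suc zero) (punchIn a k)) ℤ.* det (minor (minor M a) k))
  term-punchIn a k with a Fin.≟ punchIn a k
  ... | yes a≡ = ⊥-elim (FinP.punchInᵢ≢i a k (sym a≡))
  ... | no a≢b rewrite trans (FinP.punchOut-cong a {i≢j = a≢b} refl) (FinP.punchOut-punchIn a {k}) =
    solve 5 (λ x y u v w → ((x :* y) :* (u :* v)) :* w := (x :* u) :* ((y :* v) :* w)) refl
      (sgn (toℕ a)) (sgn (toℕ k)) (M zero a) (M (suc zero) (punchIn a k)) (det (minor (minor M a) k))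
    where
    open +-*-Solver

  det≡Σterm : det M ≡ sumℤ (λ a → sumℤ (term a))
  det≡Σterm = Σℤ.σ-cong λ a → begin
      (sgn (toℕ a) ℤ.* M zero a) ℤ.* det (minor M a)
    ≡⟨ Σℤ.σ-*ˡ (sgn (toℕ a) ℤ.* M zero a) (λ k → (sgn (toℕ k) ℤ.* M (suc zero) (punchIn a k)) ℤ.* det (minor (minor M a) k)) ⟨
      sumℤ (λ k → (sgn (toℕ a) ℤ.* M zero a) ℤ.*
                  ((sgn (toℕ k) ℤ.* M (suc zero) (punchIn a k)) ℤ.* det (minor (minor M a) k)))
    ≡⟨ Σℤ.σ-cong (λ k → term-punchIn a k) ⟨
      sumℤ (term a ∘ punchIn a)
    ≡⟨ ℤP.+-identityˡ _ ⟨
      + 0 ℤ.+ sumℤ (term a ∘ punchIn a)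
    ≡⟨ cong (ℤ._+ sumℤ (term a ∘ punchIn a)) (term-diagonal a) ⟨
      term a a ℤ.+ sumℤ (term a ∘ punchIn a)
    ≡⟨ Σℤ.σ-remove a (term a) ⟨
      sumℤ (term a)
    ∎
    where open ≡-Reasoning

module _ {n : ℕ} (M : Mat ℤ (suc (suc n)) (suc (suc n))) where
  private
    module E = TwoRowExpansion M
    module E′ = TwoRowExpansion (swapAdjacent M zero)

  term-swap : ∀ a b → E′.term a b ≡ ℤ.- E.term b a
  term-swap a b with a Fin.≟ b | b Fin.≟ a
  ... | yes _ | yes _ = refl
  ... | yes a≡b | no b≢a = ⊥-elim (b≢a (sym a≡b))
  ... | no a≢b | yes b≡a = ⊥-elim (a≢b (sym b≡a))
  ... | no a≢b | no b≢a rewrite sgn-punchOut-antisym a≢b b≢a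
                             | det-cong (λ r s → cong (M (suc (suc r))) (punchIn-punchOut-comm a≢b b≢a s)) =
    solve 4 (λ y u v w → ((:- y) :* (u :* v)) :* w := :- ((y :* (v :* u)) :* w)) refl
      (sgn (toℕ b) ℤ.* sgn (toℕ (punchOut b≢a))) (M (suc zero) a) (M zero b) (E.rest b a b≢a)
    where open +-*-Solver

  det-swap₀ : det (swapAdjacent M zero) ≡ ℤ.- det M
  det-swap₀ = begin
      det (swapAdjacent M zero)
    ≡⟨ E′.det≡Σterm ⟩
      sumℤ (λ a → sumℤ (λ b → E′.term a b))
    ≡⟨ Σℤ.σ-cong (λ a → trans (Σℤ.σ-cong (λ b → term-swap a b)) (Σℤ.σ-neg (λ b → E.term b a))) ⟩
      sumℤ (λ a → ℤ.- sumℤ (λ b → E.term b a))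
    ≡⟨ Σℤ.σ-neg (λ a → sumℤ (λ b → E.term b a)) ⟩
      ℤ.- sumℤ (λ a → sumℤ (λ b → E.term b a))
    ≡⟨ cong ℤ.-_ (Σℤ.σ-comm (λ a b → E.term b a)) ⟩
      ℤ.- sumℤ (λ b → sumℤ (E.term b))
    ≡⟨ cong ℤ.-_ E.det≡Σterm ⟨
      ℤ.- det M
    ∎
    where open ≡-Reasoning

det-swapAdjacent : ∀ {n} (M : Mat ℤ (suc n) (suc n)) (r : Fin n) → det (swapAdjacent M r) ≡ ℤ.- det M
det-swapAdjacent {suc n} M zero = det-swap₀ M
det-swapAdjacent {suc n} M (suc r) = begin
    sumℤ (λ j → s j ℤ.* det (minor (swapAdjacent M (suc r)) j))
  ≡⟨ Σℤ.σ-cong (λ j → cong (s j ℤ.*_) (trans (det-cong (λ r′ s′ →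
        sym (cong-app (swapAdjacent-∘ (_∘ punchIn j) (M ∘ suc) r r′) s′))) (det-swapAdjacent (minor M j) r))) ⟩
    sumℤ (λ j → s j ℤ.* ℤ.- det (minor M j))
  ≡⟨ Σℤ.σ-cong (λ j → ℤP.neg-distribʳ-* (s j) (det (minor M j))) ⟨
    sumℤ (λ j → ℤ.- (s j ℤ.* det (minor M j)))
  ≡⟨ Σℤ.σ-neg (λ j → s j ℤ.* det (minor M j)) ⟩
    ℤ.- det M
  ∎
  where
  open ≡-Reasoning
  s : Fin (suc (suc n)) → ℤ
  s j = sgn (toℕ j) ℤ.* M zero j

x≡-x⇒x≡0 : ∀ x → x ≡ ℤ.- x → x ≡ + 0
x≡-x⇒x≡0 (+ zero) _ = refl
x≡-x⇒x≡0 (+ suc n) ()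
x≡-x⇒x≡0 ℤ.-[1+ n ] ()

swapAdjacent-equal : ∀ {n m} {R : Set} (M : Fin (suc n) → Fin m → R) (r : Fin n) →
  (∀ s → M (inject₁ r) s ≡ M (suc r) s) → ∀ i s → swapAdjacent M r i s ≡ M i s
swapAdjacent-equal M zero eq zero s = sym (eq s)
swapAdjacent-equal M zero eq (suc zero) s = eq s
swapAdjacent-equal M zero eq (suc (suc i)) s = refl
swapAdjacent-equal M (suc r) eq zero s = refl
swapAdjacent-equal M (suc r) eq (suc i) s = swapAdjacent-equal (M ∘ suc) r eq i s

swapAdjacent-below : ∀ {n} {R : Set} (f : Fin (suc n) → R) (r : Fin n) (i : Fin (suc n)) →
  toℕ i ℕ.< toℕ r → swapAdjacent f r i ≡ f i
swapAdjacent-below f (suc r) zero _ = refl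
swapAdjacent-below f (suc r) (suc i) (ℕ.s≤s i<r) = swapAdjacent-below (f ∘ suc) r i i<r

swapAdjacent-inject₁ : ∀ {n} {R : Set} (f : Fin (suc n) → R) (r : Fin n) →
  swapAdjacent f r (inject₁ r) ≡ f (suc r)
swapAdjacent-inject₁ f zero = refl
swapAdjacent-inject₁ f (suc r) = swapAdjacent-inject₁ (f ∘ suc) r

swapAdjacent-suc : ∀ {n} {R : Set} (f : Fin (suc n) → R) (r : Fin n) →
  swapAdjacent f r (suc r) ≡ f (inject₁ r)
swapAdjacent-suc f zero = refl
swapAdjacent-suc f (suc r) = swapAdjacent-suc (f ∘ suc) r

-- Induction on the distance d between the two equal rows: swapping row b with the row
-- above it brings the pair one step closer and only changes the sign.
det-equal-rows-at : ∀ {n} (M : Mat ℤ (suc n) (suc n)) (a b : Fin (suc n)) d →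
  toℕ b ≡ suc (d ℕ.+ toℕ a) → (∀ s → M a s ≡ M b s) → det M ≡ + 0
det-equal-rows-at M a (suc r) zero b≡ Ma≡Mb =
  x≡-x⇒x≡0 (det M) (trans (det-cong (λ i s → sym (swapAdjacent-equal M r Mr≡Mr+1 i s))) (det-swapAdjacent M r))
  where
  a≡r : a ≡ inject₁ r
  a≡r = FinP.toℕ-injective (trans (ℕP.suc-injective (sym b≡)) (sym (FinP.toℕ-inject₁ r)))
  Mr≡Mr+1 : ∀ s → M (inject₁ r) s ≡ M (suc r) s
  Mr≡Mr+1 s = trans (cong (λ i → M i s) (sym a≡r)) (Ma≡Mb s)
det-equal-rows-at M a (suc r) (suc d) b≡ Ma≡Mb = begin
  det M                          ≡⟨ ℤP.neg-involutive (det M) ⟨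
  ℤ.- (ℤ.- det M)                ≡⟨ cong ℤ.-_ (det-swapAdjacent M r) ⟨
  ℤ.- det (swapAdjacent M r)     ≡⟨ cong ℤ.-_ swapped≡0 ⟩
  + 0                            ∎
  where
  open ≡-Reasoning
  r≡ : toℕ r ≡ suc (d ℕ.+ toℕ a)
  r≡ = ℕP.suc-injective b≡
  a<r : toℕ a ℕ.< toℕ r
  a<r = subst (toℕ a ℕ.<_) (sym r≡) (ℕ.s≤s (ℕP.m≤n+m (toℕ a) d))
  swapped≡0 : det (swapAdjacent M r) ≡ + 0
  swapped≡0 = det-equal-rows-at (swapAdjacent M r) a (inject₁ r) d (trans (FinP.toℕ-inject₁ r) r≡)
    (λ s → trans (cong-app (swapAdjacent-below M r a a<r) s)
             (trans (Ma≡Mb s) (sym (cong-app (swapAdjacent-inject₁ M r) s))))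

det-equal-rows : ∀ {n} (M : Mat ℤ n n) (a b : Fin n) → toℕ a ℕ.< toℕ b →
  (∀ s → M a s ≡ M b s) → det M ≡ + 0
det-equal-rows {suc n} M a b a<b =
  det-equal-rows-at M a b (toℕ b ℕ.∸ suc (toℕ a))
    (sym (trans (sym (ℕP.+-suc _ (toℕ a))) (ℕP.m∸n+n≡m a<b)))

det-lowerTriangular : ∀ {n} (M : Mat ℤ n n) → (∀ i j → toℕ i ℕ.< toℕ j → M i j ≡ + 0) →
  det M ≡ ∏ℤ (λ i → M i i)
det-lowerTriangular {zero} M upper≡0 = refl
det-lowerTriangular {suc n} M upper≡0 = begin
  det M                                                   ≡⟨ Σℤ.σ-delta zero _ off-diagonal≡0 ⟩
  (+ 1 ℤ.* M zero zero) ℤ.* det (minor M zero)            ≡⟨ cong₂ ℤ._*_ (ℤP.*-identityˡ (M zero zero)) IH ⟩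
  M zero zero ℤ.* ∏ℤ (λ i → M (suc i) (suc i))             ∎
  where
  open ≡-Reasoning
  IH : det (minor M zero) ≡ ∏ℤ (λ i → M (suc i) (suc i))
  IH = det-lowerTriangular (minor M zero) (λ i j i<j → upper≡0 (suc i) (suc j) (ℕ.s≤s i<j))
  off-diagonal≡0 : ∀ j → j ≢ zero → (sgn (toℕ j) ℤ.* M zero j) ℤ.* det (minor M j) ≡ + 0
  off-diagonal≡0 zero j≢0 = ⊥-elim (j≢0 refl)
  off-diagonal≡0 (suc j) _ rewrite upper≡0 zero (suc j) (ℕ.s≤s ℕ.z≤n) | ℤP.*-zeroʳ (sgn (suc (toℕ j))) = refl

fromℕ-or-inject₁ : ∀ {m} (i : Fin (suc m)) → (i ≡ fromℕ m) ⊎ (∃ λ r → i ≡ inject₁ r)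
fromℕ-or-inject₁ {zero} zero = inj₁ refl
fromℕ-or-inject₁ {suc m} zero = inj₂ (zero , refl)
fromℕ-or-inject₁ {suc m} (suc i) with fromℕ-or-inject₁ i
... | inj₁ i≡ = inj₁ (cong suc i≡)
... | inj₂ (r , i≡) = inj₂ (suc r , cong suc i≡)

stack-inject₁ : ∀ {n} {X : Set} (H : Fin n → X) (x : X) (i : Fin n) → stack H x (inject₁ i) ≡ H i
stack-inject₁ {suc n} H x zero = refl
stack-inject₁ {suc n} H x (suc i) = stack-inject₁ (H ∘ suc) x i

stack-fromℕ : ∀ {n} {X : Set} (H : Fin n → X) (x : X) → stack H x (fromℕ n) ≡ x
stack-fromℕ {zero} H x = refl
stack-fromℕ {suc n} H x = stack-fromℕ (H ∘ suc) x

punchIn-inject₁-fromℕ : ∀ {m} (i : Fin (suc m)) → punchIn (inject₁ i) (fromℕ m) ≡ fromℕ (suc m)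
punchIn-inject₁-fromℕ {m} zero = refl
punchIn-inject₁-fromℕ {suc m} (suc i) = cong suc (punchIn-inject₁-fromℕ i)

-- The square submatrix of (H ; x) without row i of H, as in the definition of ΔA.
stackWithout : ∀ {n} {R : Set} → (Fin n → R) → R → Fin n → Fin n → R
stackWithout H x i r = stack H x (punchIn (inject₁ i) r)

stackWithout-fromℕ : ∀ {m} {R : Set} (H : Fin (suc m) → R) x i → stackWithout H x i (fromℕ m) ≡ x
stackWithout-fromℕ {m} H x i = trans (cong (stack H x) (punchIn-inject₁-fromℕ i)) (stack-fromℕ H x)

stackWithout-updateLast : ∀ {m} {R : Set} (H : Fin (suc m) → R) x y i k →
  updateAt (stackWithout H x i) (fromℕ m) (const y) k ≡ stackWithout H y i k
stackWithout-updateLast {m} H x y i k with k Fin.≟ fromℕ m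
... | yes refl = trans (updateAt-updates (fromℕ m) (stackWithout H x i)) (sym (stackWithout-fromℕ H y i))
... | no k≢last with fromℕ-or-inject₁ (punchIn (inject₁ i) k)
...   | inj₁ k′≡last = ⊥-elim (k≢last (FinP.punchIn-injective (inject₁ i) k (fromℕ m)
                                        (trans k′≡last (sym (punchIn-inject₁-fromℕ i)))))
...   | inj₂ (r , k′≡r) = begin
  updateAt (stackWithout H x i) (fromℕ m) (const y) k ≡⟨ updateAt-minimal k (fromℕ m) (stackWithout H x i) k≢last ⟩
  stack H x (punchIn (inject₁ i) k)                    ≡⟨ cong (stack H x) k′≡r ⟩
  stack H x (inject₁ r)                                ≡⟨ stack-inject₁ H x r ⟩
  H r                                                  ≡⟨ stack-inject₁ H y r ⟨
  stack H y (inject₁ r)                                ≡⟨ cong (stack H y) k′≡r ⟨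
  stackWithout H y i k                                 ∎
  where open ≡-Reasoning

stackWithout-swapAdjacent : ∀ {m} {R : Set} (H : Fin (suc m) → R) x (r : Fin m) k →
  stackWithout H x (inject₁ r) k ≡ stackWithout (swapAdjacent H r) x (suc r) k
stackWithout-swapAdjacent {suc m} H x zero zero = refl
stackWithout-swapAdjacent {suc m} H x zero (suc k) = refl
stackWithout-swapAdjacent {suc m} H x (suc r) zero = refl
stackWithout-swapAdjacent {suc m} H x (suc r) (suc k) = stackWithout-swapAdjacent (H ∘ suc) x r k

stackWithout-last : ∀ {m} {R : Set} (H : Fin (suc m) → R) k → stackWithout H (H (fromℕ m)) (fromℕ m) k ≡ H k
stackWithout-last {zero} H zero = refl
stackWithout-last {suc m} H zero = refl
stackWithout-last {suc m} H (suc k) = stackWithout-last (H ∘ suc) k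

-- Moving row i to the bottom is a product of m − i adjacent transpositions.
∣det-moveRowToEnd∣-at : ∀ {m} d (H : Mat ℤ (suc m) (suc m)) (i : Fin (suc m)) → toℕ i ℕ.+ d ≡ m →
  ℤ.∣ det (stackWithout H (H i) i) ∣ ≡ ℤ.∣ det H ∣
∣det-moveRowToEnd∣-at {m} d H i i+d≡m with fromℕ-or-inject₁ i
... | inj₁ refl = cong ℤ.∣_∣ (det-cong (λ k s → cong-app (stackWithout-last H k) s))
∣det-moveRowToEnd∣-at {m} zero H i i+d≡m | inj₂ (r , refl) =
  ⊥-elim (ℕP.<-irrefl (trans (sym (FinP.toℕ-inject₁ r)) (trans (sym (ℕP.+-identityʳ _)) i+d≡m)) (FinP.toℕ<n r))
∣det-moveRowToEnd∣-at {m} (suc d) H i i+d≡m | inj₂ (r , refl) = begin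
    ℤ.∣ det (stackWithout H (H (inject₁ r)) (inject₁ r)) ∣
  ≡⟨ cong ℤ.∣_∣ (det-cong (λ k s → cong-app (moved≡ k) s)) ⟩
    ℤ.∣ det (stackWithout H′ (H′ (suc r)) (suc r)) ∣
  ≡⟨ ∣det-moveRowToEnd∣-at d H′ (suc r) r+1+d≡m ⟩
    ℤ.∣ det H′ ∣
  ≡⟨ cong ℤ.∣_∣ (det-swapAdjacent H r) ⟩
    ℤ.∣ ℤ.- det H ∣
  ≡⟨ ℤP.∣-i∣≡∣i∣ (det H) ⟩
    ℤ.∣ det H ∣
  ∎
  where
  open ≡-Reasoning
  H′ : Mat ℤ (suc m) (suc m)
  H′ = swapAdjacent H r
  r+1+d≡m : suc (toℕ r) ℕ.+ d ≡ m
  r+1+d≡m = trans (cong (λ x → suc x ℕ.+ d) (sym (FinP.toℕ-inject₁ r))) (trans (sym (ℕP.+-suc _ d)) i+d≡m)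
  moved≡ : ∀ k → stackWithout H (H (inject₁ r)) (inject₁ r) k ≡ stackWithout H′ (H′ (suc r)) (suc r) k
  moved≡ k = trans (stackWithout-swapAdjacent H (H (inject₁ r)) r k)
                   (cong (λ x → stackWithout H′ x (suc r) k) (sym (swapAdjacent-suc H r)))

∣det-moveRowToEnd∣ : ∀ {m} (H : Mat ℤ (suc m) (suc m)) (i : Fin (suc m)) →
  ℤ.∣ det (stackWithout H (H i) i) ∣ ≡ ℤ.∣ det H ∣
∣det-moveRowToEnd∣ {m} H i = ∣det-moveRowToEnd∣-at (m ℕ.∸ toℕ i) H i (ℕP.m+[n∸m]≡n (FinP.toℕ≤pred[n] i))

det-stackWithout-repeated : ∀ {m} (H : Mat ℤ (suc m) (suc m)) (i k : Fin (suc m)) → k ≢ i →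
  det (stackWithout H (H k) i) ≡ + 0
det-stackWithout-repeated {m} H i k k≢i =
  det-equal-rows (stackWithout H (H k) i) r (fromℕ m) r<m (λ s → cong-app rows≡ s)
  where
  i≢k : inject₁ i ≢ inject₁ k
  i≢k i≡k = k≢i (sym (FinP.inject₁-injective i≡k))
  r : Fin (suc m)
  r = punchOut i≢k
  row-r : stackWithout H (H k) i r ≡ H k
  row-r = trans (cong (stack H (H k)) (FinP.punchIn-punchOut i≢k)) (stack-inject₁ H (H k) k)
  rows≡ : stackWithout H (H k) i r ≡ stackWithout H (H k) i (fromℕ m)
  rows≡ = trans row-r (sym (stackWithout-fromℕ H (H k) i))
  r<m : toℕ r ℕ.< toℕ (fromℕ m)
  r<m with fromℕ-or-inject₁ r
  ... | inj₂ (r′ , r≡) = subst₂ ℕ._<_ (trans (sym (FinP.toℕ-inject₁ r′)) (cong toℕ (sym r≡)))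
                                   (sym (FinP.toℕ-fromℕ m)) (FinP.toℕ<n r′)
  ... | inj₁ r≡last = ⊥-elim (FinP.fromℕ≢inject₁ (trans (sym (punchIn-inject₁-fromℕ i))
                        (trans (cong (punchIn (inject₁ i)) (sym r≡last)) (FinP.punchIn-punchOut i≢k))))

-- Cramer's rule for c = −Hᵀt, after clearing the denominators of t with Q = ∏ ↧ tᵢ:
-- expanding det (stackWithout H (Q c) i) along its last row gives both Q · Dᵢ and
-- ± (Q tᵢ) · det H, since all other rows Hₖ (k ≢ i) of the expansion repeat a row.
module Cramer {m : ℕ} (H : Mat ℤ (suc m) (suc m)) (c : Fin (suc m) → ℤ) (t : Fin (suc m) → ℚ)
  (c≡-Hᵀt : ∀ j → toℚ (c j) ≡ ℚ.- sumℚ (λ i → toℚ (H i j) ℚ.* t i)) where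

  Qₙ : ℕ
  Qₙ = ∏ℕ (λ i → ℚ.↧ₙ (t i))

  Q : ℤ
  Q = + Qₙ

  1≤Qₙ : 1 ℕ.≤ Qₙ
  1≤Qₙ = ∏ℕ-positive (λ i → ℚ.↧ₙ (t i)) (λ i → ℕ.s≤s ℕ.z≤n)

  p : Fin (suc m) → ℤ
  p i = ℚ.↥ (t i) ℤ.* + ∏ℕ (λ k → ℚ.↧ₙ (t (punchIn i k)))

  t*Q≡p : ∀ i → t i ℚ.* toℚ Q ≡ toℚ (p i)
  t*Q≡p i = begin
      t i ℚ.* toℚ Q
    ≡⟨ cong (λ x → t i ℚ.* toℚ (+ x)) (∏ℕ-remove (λ i → ℚ.↧ₙ (t i))) ⟩
      t i ℚ.* toℚ (+ (ℚ.↧ₙ (t i) ℕ.* R))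
    ≡⟨ cong (λ x → t i ℚ.* toℚ x) (ℤP.pos-* (ℚ.↧ₙ (t i)) R) ⟩
      t i ℚ.* toℚ (ℚ.↧ (t i) ℤ.* + R)
    ≡⟨ cong (t i ℚ.*_) (toℚ-* (ℚ.↧ (t i)) (+ R)) ⟩
      t i ℚ.* (toℚ (ℚ.↧ (t i)) ℚ.* toℚ (+ R))
    ≡⟨ ℚP.*-assoc (t i) _ _ ⟨
      (t i ℚ.* toℚ (ℚ.↧ (t i))) ℚ.* toℚ (+ R)
    ≡⟨ cong (ℚ._* toℚ (+ R)) (p*↧p≡↥p (t i)) ⟩
      toℚ (ℚ.↥ (t i)) ℚ.* toℚ (+ R)
    ≡⟨ toℚ-* (ℚ.↥ (t i)) (+ R) ⟨
      toℚ (p i)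
    ∎
    where
    open ≡-Reasoning
    R : ℕ
    R = ∏ℕ (λ k → ℚ.↧ₙ (t (punchIn i k)))

  Q*c≡Σ-pH : ∀ s → Q ℤ.* c s ≡ sumℤ (λ k → ℤ.- p k ℤ.* H k s)
  Q*c≡Σ-pH s = toℚ-injective (begin
      toℚ (Q ℤ.* c s)
    ≡⟨ toℚ-* Q (c s) ⟩
      toℚ Q ℚ.* toℚ (c s)
    ≡⟨ cong (toℚ Q ℚ.*_) (c≡-Hᵀt s) ⟩
      toℚ Q ℚ.* ℚ.- sumℚ (λ i → toℚ (H i s) ℚ.* t i)
    ≡⟨ ℚP.neg-distribʳ-* (toℚ Q) _ ⟨
      ℚ.- (toℚ Q ℚ.* sumℚ (λ i → toℚ (H i s) ℚ.* t i))
    ≡⟨ cong ℚ.-_ (Σℚ.σ-*ˡ (toℚ Q) (λ i → toℚ (H i s) ℚ.* t i)) ⟨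
      ℚ.- sumℚ (λ i → toℚ Q ℚ.* (toℚ (H i s) ℚ.* t i))
    ≡⟨ Σℚ.σ-neg (λ i → toℚ Q ℚ.* (toℚ (H i s) ℚ.* t i)) ⟨
      sumℚ (λ i → ℚ.- (toℚ Q ℚ.* (toℚ (H i s) ℚ.* t i)))
    ≡⟨ Σℚ.σ-cong (λ i → term≡ i) ⟩
      sumℚ (λ k → toℚ (ℤ.- p k ℤ.* H k s))
    ≡⟨ toℚ-sumℤ (λ k → ℤ.- p k ℤ.* H k s) ⟨
      toℚ (sumℤ (λ k → ℤ.- p k ℤ.* H k s))
    ∎)
    where
    open ≡-Reasoning
    term≡ : ∀ i → ℚ.- (toℚ Q ℚ.* (toℚ (H i s) ℚ.* t i)) ≡ toℚ (ℤ.- p i ℤ.* H i s)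
    term≡ i = begin
      ℚ.- (toℚ Q ℚ.* (toℚ (H i s) ℚ.* t i))   ≡⟨ cong ℚ.-_ (solve 3 (λ q h x → q :* (h :* x) := (x :* q) :* h) refl
                                                                   (toℚ Q) (toℚ (H i s)) (t i)) ⟩
      ℚ.- ((t i ℚ.* toℚ Q) ℚ.* toℚ (H i s))   ≡⟨ cong (λ x → ℚ.- (x ℚ.* toℚ (H i s))) (t*Q≡p i) ⟩
      ℚ.- (toℚ (p i) ℚ.* toℚ (H i s))         ≡⟨ ℚP.neg-distribˡ-* (toℚ (p i)) (toℚ (H i s)) ⟩
      ℚ.- toℚ (p i) ℚ.* toℚ (H i s)           ≡⟨ cong (ℚ._* toℚ (H i s)) (toℚ-neg (p i)) ⟨
      toℚ (ℤ.- p i) ℚ.* toℚ (H i s)           ≡⟨ toℚ-* (ℤ.- p i) (H i s) ⟨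
      toℚ (ℤ.- p i ℤ.* H i s)                 ∎
      where open ℚSolver.+-*-Solver

  module _ (i : Fin (suc m)) where
    N : Mat ℤ (suc m) (suc m)
    N = stackWithout H (λ s → Q ℤ.* c s) i

    N-last : ∀ s → N (fromℕ m) s ≡ Q ℤ.* c s
    N-last s = cong-app (stackWithout-fromℕ H (λ s → Q ℤ.* c s) i) s

    det-N≡Q*D : det N ≡ Q ℤ.* det (stackWithout H c i)
    det-N≡Q*D = begin
      det N                                              ≡⟨ det-row-linear N (fromℕ m) {1} (const Q) (const c)
                                                              (λ s → trans (N-last s) (sym (ℤP.+-identityʳ (Q ℤ.* c s)))) ⟩
      Q ℤ.* det (updateAt N (fromℕ m) (const c)) ℤ.+ + 0 ≡⟨ ℤP.+-identityʳ _ ⟩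
      Q ℤ.* det (updateAt N (fromℕ m) (const c))         ≡⟨ cong (Q ℤ.*_) (det-cong (λ r s →
                                                              cong-app (stackWithout-updateLast H (λ s → Q ℤ.* c s) c i r) s)) ⟩
      Q ℤ.* det (stackWithout H c i)                     ∎
      where open ≡-Reasoning

    det-N≡-p*det : det N ≡ ℤ.- p i ℤ.* det (stackWithout H (H i) i)
    det-N≡-p*det = begin
        det N
      ≡⟨ det-row-linear N (fromℕ m) (λ k → ℤ.- p k) H (λ s → trans (N-last s) (Q*c≡Σ-pH s)) ⟩
        sumℤ (λ k → ℤ.- p k ℤ.* det (updateAt N (fromℕ m) (const (H k))))
      ≡⟨ Σℤ.σ-cong (λ k → cong (ℤ.- p k ℤ.*_) (det-cong (λ r s →
            cong-app (stackWithout-updateLast H (λ s → Q ℤ.* c s) (H k) i r) s))) ⟩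
        sumℤ (λ k → ℤ.- p k ℤ.* det (stackWithout H (H k) i))
      ≡⟨ Σℤ.σ-delta i (λ k → ℤ.- p k ℤ.* det (stackWithout H (H k) i))
           (λ k k≢i → trans (cong (ℤ.- p k ℤ.*_) (det-stackWithout-repeated H i k k≢i)) (ℤP.*-zeroʳ (ℤ.- p k))) ⟩
        ℤ.- p i ℤ.* det (stackWithout H (H i) i)
      ∎
      where open ≡-Reasoning

    cramer : Qₙ ℕ.* ℤ.∣ det (stackWithout H c i) ∣ ≡ ℤ.∣ p i ∣ ℕ.* ℤ.∣ det H ∣
    cramer = begin
      Qₙ ℕ.* ℤ.∣ det (stackWithout H c i) ∣                    ≡⟨ ℤP.abs-* Q _ ⟨
      ℤ.∣ Q ℤ.* det (stackWithout H c i) ∣                     ≡⟨ cong ℤ.∣_∣ (trans (sym det-N≡Q*D) det-N≡-p*det) ⟩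
      ℤ.∣ ℤ.- p i ℤ.* det (stackWithout H (H i) i) ∣           ≡⟨ ℤP.abs-* (ℤ.- p i) _ ⟩
      ℤ.∣ ℤ.- p i ∣ ℕ.* ℤ.∣ det (stackWithout H (H i) i) ∣     ≡⟨ cong₂ ℕ._*_ (ℤP.∣-i∣≡∣i∣ (p i)) (∣det-moveRowToEnd∣ H i) ⟩
      ℤ.∣ p i ∣ ℕ.* ℤ.∣ det H ∣                                ∎
      where open ≡-Reasoning

  ∣t∣≤1 : 0 ℕ.< ℤ.∣ det H ∣ → (∀ i → ℤ.∣ det (stackWithout H c i) ∣ ℕ.≤ ℤ.∣ det H ∣) →
    ∀ i → ℚ.∣ t i ∣ ℚ.≤ 1ℚ
  ∣t∣≤1 0<det D≤det i = ℚP.*-cancelʳ-≤-pos (toℚ Q) (begin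
    ℚ.∣ t i ∣ ℚ.* toℚ Q         ≡⟨ cong (ℚ.∣ t i ∣ ℚ.*_) (∣toℚ∣ Q) ⟨
    ℚ.∣ t i ∣ ℚ.* ℚ.∣ toℚ Q ∣   ≡⟨ ℚP.∣p*q∣≡∣p∣*∣q∣ (t i) (toℚ Q) ⟨
    ℚ.∣ t i ℚ.* toℚ Q ∣         ≡⟨ trans (cong ℚ.∣_∣ (t*Q≡p i)) (∣toℚ∣ (p i)) ⟩
    toℚ (+ ℤ.∣ p i ∣)           ≤⟨ toℚ-mono-≤ (ℤ.+≤+ ∣p∣≤Q) ⟩
    toℚ Q                       ≡⟨ ℚP.*-identityˡ (toℚ Q) ⟨
    1ℚ ℚ.* toℚ Q                ∎)
    where
    open ℚP.≤-Reasoning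
    instance
      Q>0 : ℚ.Positive (toℚ Q)
      Q>0 = ℚ.positive (toℚ-mono-< (ℤ.+<+ 1≤Qₙ))
    ∣p∣≤Q : ℤ.∣ p i ∣ ℕ.≤ Qₙ
    ∣p∣≤Q = ℕP.*-cancelʳ-≤ ℤ.∣ p i ∣ Qₙ ℤ.∣ det H ∣ {{ℕ.>-nonZero 0<det}}
      (subst (ℕ._≤ Qₙ ℕ.* ℤ.∣ det H ∣) (cramer i) (ℕP.*-monoʳ-≤ Qₙ (D≤det i)))

∣multipliers∣≤1 : ∀ {n} (H : Mat ℤ n n) (c : Fin n → ℤ) (t : Fin n → ℚ) →
  (∀ j → toℚ (c j) ≡ ℚ.- sumℚ (λ i → toℚ (H i j) ℚ.* t i)) → 0 ℕ.< ℤ.∣ det H ∣ →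
  (∀ i → ℤ.∣ det (stackWithout H c i) ∣ ℕ.≤ ℤ.∣ det H ∣) → ∀ i → ℚ.∣ t i ∣ ℚ.≤ 1ℚ
∣multipliers∣≤1 {zero} H c t c≡-Hᵀt 0<det D≤det ()
∣multipliers∣≤1 {suc m} H c t c≡-Hᵀt = Cramer.∣t∣≤1 H c t c≡-Hᵀt

-- Triangular systems

private
  x*[y*x⁻¹]≡y : ∀ x y .{{_ : ℚ.NonZero x}} → x ℚ.* (y ℚ.* ℚ.1/ x) ≡ y
  x*[y*x⁻¹]≡y x y = begin
    x ℚ.* (y ℚ.* ℚ.1/ x)  ≡⟨ cong (x ℚ.*_) (ℚP.*-comm y (ℚ.1/ x)) ⟩
    x ℚ.* (ℚ.1/ x ℚ.* y)  ≡⟨ ℚP.*-assoc x (ℚ.1/ x) y ⟨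
    (x ℚ.* ℚ.1/ x) ℚ.* y  ≡⟨ cong (ℚ._* y) (ℚP.*-inverseʳ x) ⟩
    1ℚ ℚ.* y              ≡⟨ ℚP.*-identityˡ y ⟩
    y                     ∎
    where open ≡-Reasoning

  [x-y]+y≡x : ∀ x y → (x ℚ.- y) ℚ.+ y ≡ x
  [x-y]+y≡x x y = trans (ℚP.+-assoc x (ℚ.- y) y) (trans (cong (x ℚ.+_) (ℚP.+-inverseˡ y)) (ℚP.+-identityʳ x))

  cons : ∀ {n} {X : Set} → X → (Fin n → X) → Fin (suc n) → X
  cons x f zero = x
  cons x f (suc i) = f i

solve-transposed-lowerTriangular : ∀ {n} (A : Mat ℚ n n) →
  (∀ i j → toℕ i ℕ.< toℕ j → A i j ≡ 0ℚ) → (∀ i → A i i ≢ 0ℚ) →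
  (r : Fin n → ℚ) → Σ (Fin n → ℚ) λ t → ∀ j → sumℚ (λ i → A i j ℚ.* t i) ≡ r j
solve-transposed-lowerTriangular {zero} A upper≡0 diag≢0 r = (λ ()) , (λ ())
solve-transposed-lowerTriangular {suc m} A upper≡0 diag≢0 r = cons t₀ t′ , solves
  where
  instance
    A₀₀≢0 : ℚ.NonZero (A zero zero)
    A₀₀≢0 = ℚ.≢-nonZero (diag≢0 zero)
  A′ : Mat ℚ m m
  A′ i j = A (suc i) (suc j)
  IH : Σ (Fin m → ℚ) λ t → ∀ j → sumℚ (λ i → A′ i j ℚ.* t i) ≡ r (suc j)
  IH = solve-transposed-lowerTriangular A′ (λ i j i<j → upper≡0 (suc i) (suc j) (ℕ.s≤s i<j))
         (diag≢0 ∘ suc) (r ∘ suc)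
  t′ : Fin m → ℚ
  t′ = proj₁ IH
  S : ℚ
  S = sumℚ (λ i → A (suc i) zero ℚ.* t′ i)
  t₀ : ℚ
  t₀ = (r zero ℚ.- S) ℚ.* ℚ.1/ A zero zero
  solves : ∀ j → sumℚ (λ i → A i j ℚ.* cons t₀ t′ i) ≡ r j
  solves zero = trans (cong (ℚ._+ S) (x*[y*x⁻¹]≡y (A zero zero) (r zero ℚ.- S))) ([x-y]+y≡x (r zero) S)
  solves (suc j) = begin
    A zero (suc j) ℚ.* t₀ ℚ.+ S′  ≡⟨ cong (λ x → x ℚ.* t₀ ℚ.+ S′) (upper≡0 zero (suc j) (ℕ.s≤s ℕ.z≤n)) ⟩
    0ℚ ℚ.* t₀ ℚ.+ S′              ≡⟨ cong (ℚ._+ S′) (ℚP.*-zeroˡ t₀) ⟩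
    0ℚ ℚ.+ S′                     ≡⟨ ℚP.+-identityˡ S′ ⟩
    S′                            ≡⟨ proj₂ IH j ⟩
    r (suc j)                     ∎
    where
    open ≡-Reasoning
    S′ : ℚ
    S′ = sumℚ (λ i → A′ i j ℚ.* t′ i)

solve-lowerTriangular : ∀ {n} (A : Mat ℚ n n) →
  (∀ i j → toℕ i ℕ.< toℕ j → A i j ≡ 0ℚ) → (∀ i → A i i ≢ 0ℚ) →
  (r : Fin n → ℚ) → Σ (Fin n → ℚ) λ d → ∀ i → sumℚ (λ j → A i j ℚ.* d j) ≡ r i
solve-lowerTriangular {zero} A upper≡0 diag≢0 r = (λ ()) , (λ ())
solve-lowerTriangular {suc m} A upper≡0 diag≢0 r = cons d₀ d′ , solves
  where
  instance
    A₀₀≢0 : ℚ.NonZero (A zero zero)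
    A₀₀≢0 = ℚ.≢-nonZero (diag≢0 zero)
  A′ : Mat ℚ m m
  A′ i j = A (suc i) (suc j)
  d₀ : ℚ
  d₀ = r zero ℚ.* ℚ.1/ A zero zero
  IH : Σ (Fin m → ℚ) λ d → ∀ i → sumℚ (λ j → A′ i j ℚ.* d j) ≡ r (suc i) ℚ.- A (suc i) zero ℚ.* d₀
  IH = solve-lowerTriangular A′ (λ i j i<j → upper≡0 (suc i) (suc j) (ℕ.s≤s i<j))
         (diag≢0 ∘ suc) (λ i → r (suc i) ℚ.- A (suc i) zero ℚ.* d₀)
  d′ : Fin m → ℚ
  d′ = proj₁ IH
  first-row-rest≡0 : sumℚ (λ j → A zero (suc j) ℚ.* d′ j) ≡ 0ℚ
  first-row-rest≡0 = trans (Σℚ.σ-cong (λ j → trans (cong (ℚ._* d′ j) (upper≡0 zero (suc j) (ℕ.s≤s ℕ.z≤n)))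
                                                   (ℚP.*-zeroˡ (d′ j))))
                           (Σℚ.σ-zeros {m})
  solves : ∀ i → sumℚ (λ j → A i j ℚ.* cons d₀ d′ j) ≡ r i
  solves zero = begin
    A zero zero ℚ.* d₀ ℚ.+ sumℚ (λ j → A zero (suc j) ℚ.* d′ j) ≡⟨ cong (A zero zero ℚ.* d₀ ℚ.+_) first-row-rest≡0 ⟩
    A zero zero ℚ.* d₀ ℚ.+ 0ℚ                                   ≡⟨ ℚP.+-identityʳ _ ⟩
    A zero zero ℚ.* d₀                                          ≡⟨ x*[y*x⁻¹]≡y (A zero zero) (r zero) ⟩
    r zero                                                      ∎
    where open ≡-Reasoning
  solves (suc i) = begin
    A (suc i) zero ℚ.* d₀ ℚ.+ sumℚ (λ j → A′ i j ℚ.* d′ j)               ≡⟨ cong (A (suc i) zero ℚ.* d₀ ℚ.+_) (proj₂ IH i) ⟩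
    A (suc i) zero ℚ.* d₀ ℚ.+ (r (suc i) ℚ.- A (suc i) zero ℚ.* d₀)      ≡⟨ ℚP.+-comm (A (suc i) zero ℚ.* d₀) _ ⟩
    (r (suc i) ℚ.- A (suc i) zero ℚ.* d₀) ℚ.+ A (suc i) zero ℚ.* d₀      ≡⟨ [x-y]+y≡x (r (suc i)) (A (suc i) zero ℚ.* d₀) ⟩
    r (suc i)                                                           ∎
    where open ≡-Reasoning

-- The simplex

module _ {n : ℕ} (H : Mat ℤ n n) (c : Fin n → ℤ) (h : Fin n → ℤ) (c0 : ℤ) where

  InS⇒split : ∀ x → InS (Asys H c h c0) (bsys H c h c0) x →
    (∀ k → dotℚ (H k) x ℚ.≤ toℚ (h k)) × (dotℚ c x ℚ.≤ toℚ c0)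
  InS⇒split x x∈S =
      (λ k → subst₂ (λ a b → dotℚ a x ℚ.≤ toℚ b) (stack-inject₁ H c k) (stack-inject₁ h c0 k) (x∈S (inject₁ k)))
    , subst₂ (λ a b → dotℚ a x ℚ.≤ toℚ b) (stack-fromℕ H c) (stack-fromℕ h c0) (x∈S (fromℕ n))

  split⇒InS : ∀ x → (∀ k → dotℚ (H k) x ℚ.≤ toℚ (h k)) → dotℚ c x ℚ.≤ toℚ c0 →
    InS (Asys H c h c0) (bsys H c h c0) x
  split⇒InS x Hx≤h cx≤c0 i with fromℕ-or-inject₁ i
  ... | inj₁ refl = subst₂ (λ a b → dotℚ a x ℚ.≤ toℚ b) (sym (stack-fromℕ H c)) (sym (stack-fromℕ h c0)) cx≤c0
  ... | inj₂ (k , refl) =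
    subst₂ (λ a b → dotℚ a x ℚ.≤ toℚ b) (sym (stack-inject₁ H c k)) (sym (stack-inject₁ h c0 k)) (Hx≤h k)

InS-cong : ∀ {n} (A : Mat ℤ (suc n) n) b {x y : Fin n → ℚ} → (∀ j → x j ≡ y j) → InS A b x → InS A b y
InS-cong A b x≡y x∈S i = subst (ℚ._≤ toℚ (b i)) (Σℚ.σ-cong (λ j → cong (toℚ (A i j) ℚ.*_) (x≡y j))) (x∈S i)

dotℚ-linear : ∀ {n} (a : Fin n → ℤ) (x y : Fin n → ℚ) L →
  dotℚ a (λ j → x j ℚ.+ L ℚ.* y j) ≡ dotℚ a x ℚ.+ L ℚ.* dotℚ a y
dotℚ-linear a x y L = begin
    sumℚ (λ j → toℚ (a j) ℚ.* (x j ℚ.+ L ℚ.* y j))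
  ≡⟨ Σℚ.σ-cong (λ j → solve 4 (λ a x L y → a :* (x :+ L :* y) := a :* x :+ L :* (a :* y)) refl
                        (toℚ (a j)) (x j) L (y j)) ⟩
    sumℚ (λ j → toℚ (a j) ℚ.* x j ℚ.+ L ℚ.* (toℚ (a j) ℚ.* y j))
  ≡⟨ Σℚ.σ-distrib-+ (λ j → toℚ (a j) ℚ.* x j) (λ j → L ℚ.* (toℚ (a j) ℚ.* y j)) ⟩
    dotℚ a x ℚ.+ sumℚ (λ j → L ℚ.* (toℚ (a j) ℚ.* y j))
  ≡⟨ cong (dotℚ a x ℚ.+_) (Σℚ.σ-*ˡ L (λ j → toℚ (a j) ℚ.* y j)) ⟩
    dotℚ a x ℚ.+ L ℚ.* dotℚ a y
  ∎
  where
  open ≡-Reasoning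
  open ℚSolver.+-*-Solver


dotℚ-scale : ∀ {n} (a : Fin n → ℤ) L (y : Fin n → ℚ) → dotℚ a (λ j → L ℚ.* y j) ≡ L ℚ.* dotℚ a y
dotℚ-scale a L y = trans (Σℚ.σ-cong (λ j → x∙yz≈y∙xz (toℚ (a j)) L (y j))) (Σℚ.σ-*ˡ L (λ j → toℚ (a j) ℚ.* y j))
  where open import Algebra.Properties.CommutativeSemigroup (CommutativeMonoid.commutativeSemigroup ℚP.*-1-commutativeMonoid) using (x∙yz≈y∙xz)

unitVec : ∀ {n} → Fin n → Fin n → ℚ
unitVec i k with k Fin.≟ i
... | yes _ = 1ℚ
... | no _ = 0ℚ

unitVec-self : ∀ {n} (i : Fin n) → unitVec i i ≡ 1ℚ
unitVec-self i with i Fin.≟ i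
... | yes _ = refl
... | no i≢i = ⊥-elim (i≢i refl)

unitVec-other : ∀ {n} (i k : Fin n) → k ≢ i → unitVec i k ≡ 0ℚ
unitVec-other i k k≢i with k Fin.≟ i
... | yes k≡i = ⊥-elim (k≢i k≡i)
... | no _ = refl

unitVec-nonNeg : ∀ {n} (i k : Fin n) → 0ℚ ℚ.≤ unitVec i k
unitVec-nonNeg i k with k Fin.≟ i
... | yes _ = ℚP.<⇒≤ (ℚP.positive⁻¹ 1ℚ)
... | no _ = ℚP.≤-refl

sumℚ-unitVec : ∀ {n} (i : Fin n) (f : Fin n → ℚ) → sumℚ (λ k → unitVec i k ℚ.* f k) ≡ f i
sumℚ-unitVec i f = begin
  sumℚ (λ k → unitVec i k ℚ.* f k) ≡⟨ Σℚ.σ-delta i (λ k → unitVec i k ℚ.* f k)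
                                       (λ k k≢i → trans (cong (ℚ._* f k) (unitVec-other i k k≢i)) (ℚP.*-zeroˡ (f k))) ⟩
  unitVec i i ℚ.* f i               ≡⟨ cong (ℚ._* f i) (unitVec-self i) ⟩
  1ℚ ℚ.* f i                        ≡⟨ ℚP.*-identityˡ (f i) ⟩
  f i                               ∎
  where open ≡-Reasoning

sumℚ-unitVec≡1 : ∀ {n} (i : Fin n) → sumℚ (unitVec i) ≡ 1ℚ
sumℚ-unitVec≡1 i = trans (Σℚ.σ-cong (λ k → sym (ℚP.*-identityʳ (unitVec i k)))) (sumℚ-unitVec i (const 1ℚ))

vertex∈hull : ∀ {n} (V : Fin (suc n) → Fin n → ℚ) i → ConvHull V (V i)
vertex∈hull V i = unitVec i , unitVec-nonNeg i , sumℚ-unitVec≡1 i , (λ j → sym (sumℚ-unitVec i (λ k → V k j)))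

convexWeight≤1 : ∀ {n} {μ : Fin n → ℚ} → (∀ i → 0ℚ ℚ.≤ μ i) → sumℚ μ ≡ 1ℚ → ∀ i → μ i ℚ.≤ 1ℚ
convexWeight≤1 0≤μ Σμ≡1 i = subst (_ ℚ.≤_) Σμ≡1 (term≤sumℚ 0≤μ i)

∣hull∣≤ : ∀ {n} (V : Fin (suc n) → Fin n → ℚ) x → ConvHull V x → ∀ j → ℚ.∣ x j ∣ ℚ.≤ sumℚ (λ k → ℚ.∣ V k j ∣)
∣hull∣≤ V x (μ , 0≤μ , Σμ≡1 , x≡) j = begin
  ℚ.∣ x j ∣                              ≡⟨ cong ℚ.∣_∣ (x≡ j) ⟩
  ℚ.∣ sumℚ (λ k → μ k ℚ.* V k j) ∣       ≤⟨ ∣sumℚ∣≤sumℚ∣∣ (λ k → μ k ℚ.* V k j) ⟩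
  sumℚ (λ k → ℚ.∣ μ k ℚ.* V k j ∣)       ≤⟨ sumℚ-mono-≤ term≤ ⟩
  sumℚ (λ k → ℚ.∣ V k j ∣)               ∎
  where
  open ℚP.≤-Reasoning
  term≤ : ∀ k → ℚ.∣ μ k ℚ.* V k j ∣ ℚ.≤ ℚ.∣ V k j ∣
  term≤ k = begin
    ℚ.∣ μ k ℚ.* V k j ∣       ≡⟨ ℚP.∣p*q∣≡∣p∣*∣q∣ (μ k) (V k j) ⟩
    ℚ.∣ μ k ∣ ℚ.* ℚ.∣ V k j ∣ ≡⟨ cong (ℚ._* ℚ.∣ V k j ∣) (ℚP.0≤p⇒∣p∣≡p (0≤μ k)) ⟩
    μ k ℚ.* ℚ.∣ V k j ∣       ≤⟨ ℚP.*-monoʳ-≤-nonNeg ℚ.∣ V k j ∣ {{ℚP.∣-∣-nonNeg (V k j)}} (convexWeight≤1 0≤μ Σμ≡1 k) ⟩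
    1ℚ ℚ.* ℚ.∣ V k j ∣        ≡⟨ ℚP.*-identityˡ _ ⟩
    ℚ.∣ V k j ∣               ∎

negUnitℤ : ∀ {n} → Fin n → Fin n → ℤ
negUnitℤ l j with j Fin.≟ l
... | yes _ = ℤ.-1ℤ
... | no _ = + 0

toℚ-negUnitℤ : ∀ {n} (l j : Fin n) → toℚ (negUnitℤ l j) ≡ ℚ.- unitVec l j
toℚ-negUnitℤ l j with j Fin.≟ l
... | yes _ = refl
... | no _ = refl

dotℚ-negUnit : ∀ {n} (a : Fin n → ℤ) l → dotℚ a (λ j → ℚ.- unitVec l j) ≡ ℚ.- toℚ (a l)
dotℚ-negUnit a l = begin
  sumℚ (λ j → toℚ (a j) ℚ.* ℚ.- unitVec l j)        ≡⟨ Σℚ.σ-cong (λ j → ℚP.neg-distribʳ-* (toℚ (a j)) _) ⟨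
  sumℚ (λ j → ℚ.- (toℚ (a j) ℚ.* unitVec l j))      ≡⟨ Σℚ.σ-neg (λ j → toℚ (a j) ℚ.* unitVec l j) ⟩
  ℚ.- sumℚ (λ j → toℚ (a j) ℚ.* unitVec l j)        ≡⟨ cong ℚ.-_ (Σℚ.σ-cong (λ j → ℚP.*-comm (toℚ (a j)) _)) ⟩
  ℚ.- sumℚ (λ j → unitVec l j ℚ.* toℚ (a j))        ≡⟨ cong ℚ.-_ (sumℚ-unitVec l (toℚ ∘ a)) ⟩
  ℚ.- toℚ (a l)                                     ∎
  where open ≡-Reasoning

bounded-multiples⇒0 : ∀ {K} d → 0ℚ ℚ.≤ K → (∀ L → 0ℚ ℚ.≤ L → ℚ.∣ L ℚ.* d ∣ ℚ.≤ K) → d ≡ 0ℚ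
bounded-multiples⇒0 {K} d 0≤K bounded with d ℚ.≟ 0ℚ
... | yes d≡0 = d≡0
... | no d≢0 = ⊥-elim (ℚP.<-irrefl refl (begin-strict
  K                 <⟨ p<p+1 K ⟩
  K ℚ.+ 1ℚ          ≡⟨ ∣Ld∣≡K+1 ⟨
  ℚ.∣ L ℚ.* d ∣     ≤⟨ bounded L 0≤L ⟩
  K                 ∎))
  where
  open ℚP.≤-Reasoning
  instance
    ∣d∣>0 : ℚ.Positive ℚ.∣ d ∣
    ∣d∣>0 = ∣p∣-positive d≢0
    ∣d∣≢0 : ℚ.NonZero ℚ.∣ d ∣
    ∣d∣≢0 = ℚP.pos⇒nonZero ℚ.∣ d ∣
    K+1>0 : ℚ.Positive (K ℚ.+ 1ℚ)
    K+1>0 = ℚ.positive (ℚP.≤-<-trans 0≤K (p<p+1 K))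
  L : ℚ
  L = (K ℚ.+ 1ℚ) ℚ.* ℚ.1/ ℚ.∣ d ∣
  0≤L : 0ℚ ℚ.≤ L
  0≤L = ℚP.<⇒≤ (ℚP.positive⁻¹ L {{ℚP.pos*pos⇒pos (K ℚ.+ 1ℚ) (ℚ.1/ ℚ.∣ d ∣) {{ℚP.1/pos⇒pos ℚ.∣ d ∣}}}})
  ∣Ld∣≡K+1 : ℚ.∣ L ℚ.* d ∣ ≡ K ℚ.+ 1ℚ
  ∣Ld∣≡K+1 = begin-equality
    ℚ.∣ L ℚ.* d ∣                                    ≡⟨ ℚP.∣p*q∣≡∣p∣*∣q∣ L d ⟩
    ℚ.∣ L ∣ ℚ.* ℚ.∣ d ∣                              ≡⟨ cong (ℚ._* ℚ.∣ d ∣) (ℚP.0≤p⇒∣p∣≡p 0≤L) ⟩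
    ((K ℚ.+ 1ℚ) ℚ.* ℚ.1/ ℚ.∣ d ∣) ℚ.* ℚ.∣ d ∣         ≡⟨ ℚP.*-assoc (K ℚ.+ 1ℚ) _ _ ⟩
    (K ℚ.+ 1ℚ) ℚ.* (ℚ.1/ ℚ.∣ d ∣ ℚ.* ℚ.∣ d ∣)         ≡⟨ cong ((K ℚ.+ 1ℚ) ℚ.*_) (ℚP.*-inverseˡ ℚ.∣ d ∣) ⟩
    (K ℚ.+ 1ℚ) ℚ.* 1ℚ                               ≡⟨ ℚP.*-identityʳ (K ℚ.+ 1ℚ) ⟩
    K ℚ.+ 1ℚ                                        ∎

convexCombination-at-vertex : ∀ {n} (V : Fin (suc n) → Fin n → ℚ) (μ : Fin (suc n) → ℚ) →
  (∀ k → 0ℚ ℚ.≤ μ k) → sumℚ μ ≡ 1ℚ → ∀ i → μ i ≡ 1ℚ → ∀ j → sumℚ (λ k → μ k ℚ.* V k j) ≡ V i j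
convexCombination-at-vertex V μ 0≤μ Σμ≡1 i μi≡1 j = begin
  sumℚ (λ k → μ k ℚ.* V k j)   ≡⟨ Σℚ.σ-delta i (λ k → μ k ℚ.* V k j)
                                    (λ k k≢i → trans (cong (ℚ._* V k j) (μ≡0 k k≢i)) (ℚP.*-zeroˡ (V k j))) ⟩
  μ i ℚ.* V i j                ≡⟨ cong (ℚ._* V i j) μi≡1 ⟩
  1ℚ ℚ.* V i j                 ≡⟨ ℚP.*-identityˡ (V i j) ⟩
  V i j                        ∎
  where
  open ≡-Reasoning
  others≡0 : sumℚ (μ ∘ punchIn i) ≡ 0ℚ
  others≡0 = begin
    sumℚ (μ ∘ punchIn i)                              ≡⟨ solve 2 (λ x y → y := (x :+ y) :- x) refl (μ i) _ ⟩
    (μ i ℚ.+ sumℚ (μ ∘ punchIn i)) ℚ.- μ i            ≡⟨ cong₂ ℚ._-_ (trans (sym (Σℚ.σ-remove i μ)) Σμ≡1) μi≡1 ⟩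
    1ℚ ℚ.- 1ℚ                                         ≡⟨ ℚP.+-inverseʳ 1ℚ ⟩
    0ℚ                                                ∎
    where open ℚSolver.+-*-Solver
  μ≡0 : ∀ k → k ≢ i → μ k ≡ 0ℚ
  μ≡0 k k≢i = ℚP.≤-antisym
    (subst₂ ℚ._≤_ (cong μ (FinP.punchIn-punchOut i≢k)) others≡0 (term≤sumℚ (0≤μ ∘ punchIn i) (punchOut i≢k)))
    (0≤μ k)
    where
    i≢k : i ≢ k
    i≢k i≡k = k≢i (sym i≡k)

two : ℚ
two = 1ℚ ℚ.+ 1ℚ

x+y≡2⇒x≡1 : ∀ {x y} → x ℚ.≤ 1ℚ → y ℚ.≤ 1ℚ → x ℚ.+ y ≡ two → x ≡ 1ℚ
x+y≡2⇒x≡1 {x} {y} x≤1 y≤1 x+y≡2 = ℚP.≤-antisym x≤1 (begin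
  1ℚ              ≤⟨ ℚP.+-monoʳ-≤ two (ℚP.neg-antimono-≤ y≤1) ⟩
  two ℚ.- y       ≡⟨ cong (ℚ._- y) (sym x+y≡2) ⟩
  (x ℚ.+ y) ℚ.- y ≡⟨ solve 2 (λ x y → (x :+ y) :- y := x) refl x y ⟩
  x               ∎)
  where
  open ℚP.≤-Reasoning
  open ℚSolver.+-*-Solver

-- If p = ∑ μₖVₖ and q = ∑ νₖVₖ with p + q = 2 Vᵢ, then μ + ν − 2eᵢ is an affine dependence.
weights-at-midpoint : ∀ {n} (V : Fin (suc n) → Fin n → ℚ) → AffIndep V → ∀ i (μ ν : Fin (suc n) → ℚ) →
  sumℚ μ ≡ 1ℚ → sumℚ ν ≡ 1ℚ →
  (∀ j → sumℚ (λ k → μ k ℚ.* V k j) ℚ.+ sumℚ (λ k → ν k ℚ.* V k j) ≡ two ℚ.* V i j) →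
  μ i ℚ.+ ν i ≡ two
weights-at-midpoint {n} V independent i μ ν Σμ≡1 Σν≡1 midpoint = begin
  μ i ℚ.+ ν i                                     ≡⟨ solve 2 (λ m n → m :+ n := ((m :+ n) :- con two :* con 1ℚ) :+ con two) refl (μ i) (ν i) ⟩
  ((μ i ℚ.+ ν i) ℚ.- two ℚ.* 1ℚ) ℚ.+ two          ≡⟨ cong (λ e → ((μ i ℚ.+ ν i) ℚ.- two ℚ.* e) ℚ.+ two) (unitVec-self i) ⟨
  λ′ i ℚ.+ two                                    ≡⟨ cong (ℚ._+ two) (independent λ′ Σλ′≡0 Σλ′V≡0 i) ⟩
  0ℚ ℚ.+ two                                      ≡⟨ ℚP.+-identityˡ two ⟩
  two                                             ∎
  where
  open ≡-Reasoning
  open ℚSolver.+-*-Solver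
  λ′ : Fin (suc n) → ℚ
  λ′ k = (μ k ℚ.+ ν k) ℚ.- two ℚ.* unitVec i k
  sum-shape : ∀ (f g e : Fin (suc n) → ℚ) →
    sumℚ (λ k → (f k ℚ.+ g k) ℚ.- two ℚ.* e k) ≡ (sumℚ f ℚ.+ sumℚ g) ℚ.- two ℚ.* sumℚ e
  sum-shape f g e = trans (Σℚ.σ-distrib-+ (λ k → f k ℚ.+ g k) (λ k → ℚ.- (two ℚ.* e k)))
    (cong₂ ℚ._+_ (Σℚ.σ-distrib-+ f g) (trans (Σℚ.σ-neg (λ k → two ℚ.* e k)) (cong ℚ.-_ (Σℚ.σ-*ˡ two e))))
  Σλ′≡0 : sumℚ λ′ ≡ 0ℚ
  Σλ′≡0 = begin
    sumℚ λ′                                            ≡⟨ sum-shape μ ν (unitVec i) ⟩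
    (sumℚ μ ℚ.+ sumℚ ν) ℚ.- two ℚ.* sumℚ (unitVec i)   ≡⟨ cong₂ (λ x y → x ℚ.- two ℚ.* y) (cong₂ ℚ._+_ Σμ≡1 Σν≡1)
                                                            (sumℚ-unitVec≡1 i) ⟩
    two ℚ.- two ℚ.* 1ℚ                                 ≡⟨⟩
    0ℚ                                                 ∎
  Σλ′V≡0 : ∀ j → sumℚ (λ k → λ′ k ℚ.* V k j) ≡ 0ℚ
  Σλ′V≡0 j = begin
      sumℚ (λ k → λ′ k ℚ.* V k j)
    ≡⟨ Σℚ.σ-cong (λ k → solve 4 (λ m n e v → ((m :+ n) :- con two :* e) :* v
                                            := (m :* v :+ n :* v) :- con two :* (e :* v)) refl
                                 (μ k) (ν k) (unitVec i k) (V k j)) ⟩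
      sumℚ (λ k → (μ k ℚ.* V k j ℚ.+ ν k ℚ.* V k j) ℚ.- two ℚ.* (unitVec i k ℚ.* V k j))
    ≡⟨ sum-shape (λ k → μ k ℚ.* V k j) (λ k → ν k ℚ.* V k j) (λ k → unitVec i k ℚ.* V k j) ⟩
      (sumℚ (λ k → μ k ℚ.* V k j) ℚ.+ sumℚ (λ k → ν k ℚ.* V k j)) ℚ.- two ℚ.* sumℚ (λ k → unitVec i k ℚ.* V k j)
    ≡⟨ cong₂ (λ x y → x ℚ.- two ℚ.* y) (midpoint j) (sumℚ-unitVec i (λ k → V k j)) ⟩
      two ℚ.* V i j ℚ.- two ℚ.* V i j
    ≡⟨ ℚP.+-inverseʳ (two ℚ.* V i j) ⟩
      0ℚ
    ∎

module SimplexGeometry {n : ℕ} (A : Mat ℤ (suc n) n) (b : Fin (suc n) → ℤ) (V : Fin (suc n) → Fin n → ℚ)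
  (simplex : SimplexWithVertices A b V) where

  S⊆hull : ∀ {x} → InS A b x → ConvHull V x
  S⊆hull {x} = proj₁ (proj₂ simplex x)

  vertex∈S : ∀ i → InS A b (V i)
  vertex∈S i = proj₂ (proj₂ simplex (V i)) (vertex∈hull V i)

  -- The simplex is bounded by ∑ₖ ∣Vₖⱼ∣ in every coordinate, so a ray inside it is a point.
  ray⊆S⇒direction≡0 : ∀ (x d : Fin n → ℚ) → (∀ L → 0ℚ ℚ.≤ L → InS A b (λ j → x j ℚ.+ L ℚ.* d j)) →
    ∀ j → d j ≡ 0ℚ
  ray⊆S⇒direction≡0 x d ray⊆S j = bounded-multiples⇒0 (d j) (ℚP.+-mono-≤ 0≤B 0≤B) ∣Ld∣≤2B
    where
    open ℚP.≤-Reasoning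
    open ℚSolver.+-*-Solver
    B : ℚ
    B = sumℚ (λ k → ℚ.∣ V k j ∣)
    0≤B : 0ℚ ℚ.≤ B
    0≤B = sumℚ-nonNeg (λ k → ℚP.0≤∣p∣ (V k j))
    on-ray : ∀ L → 0ℚ ℚ.≤ L → ℚ.∣ x j ℚ.+ L ℚ.* d j ∣ ℚ.≤ B
    on-ray L 0≤L = ∣hull∣≤ V _ (S⊆hull (ray⊆S L 0≤L)) j
    ∣Ld∣≤2B : ∀ L → 0ℚ ℚ.≤ L → ℚ.∣ L ℚ.* d j ∣ ℚ.≤ B ℚ.+ B
    ∣Ld∣≤2B L 0≤L = begin
      ℚ.∣ L ℚ.* d j ∣                                                ≡⟨ cong ℚ.∣_∣ difference ⟩
      ℚ.∣ (x j ℚ.+ L ℚ.* d j) ℚ.- (x j ℚ.+ 0ℚ ℚ.* d j) ∣              ≤⟨ ℚP.∣p-q∣≤∣p∣+∣q∣ (x j ℚ.+ L ℚ.* d j) (x j ℚ.+ 0ℚ ℚ.* d j) ⟩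
      ℚ.∣ x j ℚ.+ L ℚ.* d j ∣ ℚ.+ ℚ.∣ x j ℚ.+ 0ℚ ℚ.* d j ∣            ≤⟨ ℚP.+-mono-≤ (on-ray L 0≤L) (on-ray 0ℚ ℚP.≤-refl) ⟩
      B ℚ.+ B                                                        ∎
      where
      difference : L ℚ.* d j ≡ (x j ℚ.+ L ℚ.* d j) ℚ.- (x j ℚ.+ 0ℚ ℚ.* d j)
      difference = solve 3 (λ L d x → L :* d := (x :+ L :* d) :- (x :+ con 0ℚ :* d)) refl L (d j) (x j)

  vertex-extreme : ∀ i (w : Fin n → ℚ) → InS A b (λ j → V i j ℚ.+ w j) → InS A b (λ j → V i j ℚ.- w j) →
    ∀ j → w j ≡ 0ℚ
  vertex-extreme i w Vi+w∈S Vi-w∈S j = begin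
    w j                                        ≡⟨ solve 2 (λ v w → w := (v :+ w) :- v) refl (V i j) (w j) ⟩
    (V i j ℚ.+ w j) ℚ.- V i j                  ≡⟨ cong (ℚ._- V i j) (trans (μ-combination j)
                                                    (convexCombination-at-vertex V μ 0≤μ Σμ≡1 i μi≡1 j)) ⟩
    V i j ℚ.- V i j                            ≡⟨ ℚP.+-inverseʳ (V i j) ⟩
    0ℚ                                         ∎
    where
    open ≡-Reasoning
    open ℚSolver.+-*-Solver
    μ ν : Fin (suc n) → ℚ
    μ = proj₁ (S⊆hull Vi+w∈S)
    ν = proj₁ (S⊆hull Vi-w∈S)
    0≤μ : ∀ k → 0ℚ ℚ.≤ μ k
    0≤μ = proj₁ (proj₂ (S⊆hull Vi+w∈S))
    0≤ν : ∀ k → 0ℚ ℚ.≤ ν k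
    0≤ν = proj₁ (proj₂ (S⊆hull Vi-w∈S))
    Σμ≡1 : sumℚ μ ≡ 1ℚ
    Σμ≡1 = proj₁ (proj₂ (proj₂ (S⊆hull Vi+w∈S)))
    Σν≡1 : sumℚ ν ≡ 1ℚ
    Σν≡1 = proj₁ (proj₂ (proj₂ (S⊆hull Vi-w∈S)))
    μ-combination : ∀ j → V i j ℚ.+ w j ≡ sumℚ (λ k → μ k ℚ.* V k j)
    μ-combination = proj₂ (proj₂ (proj₂ (S⊆hull Vi+w∈S)))
    ν-combination : ∀ j → V i j ℚ.- w j ≡ sumℚ (λ k → ν k ℚ.* V k j)
    ν-combination = proj₂ (proj₂ (proj₂ (S⊆hull Vi-w∈S)))
    combinations-add-up : ∀ j → sumℚ (λ k → μ k ℚ.* V k j) ℚ.+ sumℚ (λ k → ν k ℚ.* V k j) ≡ two ℚ.* V i j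
    combinations-add-up j = begin
      sumℚ (λ k → μ k ℚ.* V k j) ℚ.+ sumℚ (λ k → ν k ℚ.* V k j) ≡⟨ cong₂ ℚ._+_ (μ-combination j) (ν-combination j) ⟨
      (V i j ℚ.+ w j) ℚ.+ (V i j ℚ.- w j)                       ≡⟨ solve 2 (λ v w → (v :+ w) :+ (v :- w) := con two :* v) refl (V i j) (w j) ⟩
      two ℚ.* V i j                                             ∎
    μi≡1 : μ i ≡ 1ℚ
    μi≡1 = x+y≡2⇒x≡1 (convexWeight≤1 0≤μ Σμ≡1 i) (convexWeight≤1 0≤ν Σν≡1 i)
             (weights-at-midpoint V (proj₁ simplex) i μ ν Σμ≡1 Σν≡1 combinations-add-up)

-- For a matrix in Hermite normal form every entry lies in [0, Hᵢᵢ), so entries and column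
-- sums are controlled by ∏ Hᵢᵢ = ∣det H∣.
module HermiteBounds {n : ℕ} (H : Mat ℤ n n) (hnf : IsHNF H) (1≤diag : ∀ i → + 1 ℤ.≤ H i i) where

  upper≡0 : ∀ i j → toℕ i ℕ.< toℕ j → H i j ≡ + 0
  upper≡0 i j = proj₁ (hnf i j)

  0≤H : ∀ i j → + 0 ℤ.≤ H i j
  0≤H i j = proj₁ (proj₂ (hnf i j))

  lower<diag : ∀ i j → toℕ j ℕ.< toℕ i → H i j ℤ.< H i i
  lower<diag i j = proj₂ (proj₂ (hnf i j))

  diagₙ : Fin n → ℕ
  diagₙ i = ℤ.∣ H i i ∣

  1≤diagₙ : ∀ i → 1 ℕ.≤ diagₙ i
  1≤diagₙ i with H i i | 1≤diag i
  ... | + _ | ℤ.+≤+ 1≤d = 1≤d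

  ∣det∣≡∏diagₙ : ℤ.∣ det H ∣ ≡ ∏ℕ diagₙ
  ∣det∣≡∏diagₙ = trans (cong ℤ.∣_∣ (det-lowerTriangular H upper≡0)) (∣∏ℤ∣≡∏ℕ∣∣ (λ i → H i i))

  0<∣det∣ : 0 ℕ.< ℤ.∣ det H ∣
  0<∣det∣ = subst (0 ℕ.<_) (sym ∣det∣≡∏diagₙ) (∏ℕ-positive diagₙ 1≤diagₙ)

  ∣H∣<diagₙ : ∀ i j → i ≢ j → ℤ.∣ H i j ∣ ℕ.< diagₙ i
  ∣H∣<diagₙ i j i≢j with ℕP.<-cmp (toℕ i) (toℕ j)
  ... | tri< i<j _ _ = subst (λ x → ℤ.∣ x ∣ ℕ.< diagₙ i) (sym (upper≡0 i j i<j)) (1≤diagₙ i)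
  ... | tri≈ _ i≡j _ = ⊥-elim (i≢j (FinP.toℕ-injective i≡j))
  ... | tri> _ _ j<i with H i j | H i i | 0≤H i j | lower<diag i j j<i
  ...   | + _ | + _ | _ | ℤ.+<+ Hij<Hii = Hij<Hii

  ∣H∣≤diagₙ : ∀ i j → ℤ.∣ H i j ∣ ℕ.≤ diagₙ i
  ∣H∣≤diagₙ i j with i Fin.≟ j
  ... | yes refl = ℕP.≤-refl
  ... | no i≢j = ℕP.<⇒≤ (∣H∣<diagₙ i j i≢j)

  ∣H∣≤∣det∣ : ∀ i j → ℤ.∣ H i j ∣ ℕ.≤ ℤ.∣ det H ∣
  ∣H∣≤∣det∣ i j = ℕP.≤-trans (∣H∣≤diagₙ i j) (subst (diagₙ i ℕ.≤_) (sym ∣det∣≡∏diagₙ) (factor≤∏ℕ diagₙ 1≤diagₙ i))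

  columnSum≤∣det∣ : ∀ j → ∑ℕ (λ i → ℤ.∣ H i j ∣) ℕ.≤ ℤ.∣ det H ∣
  columnSum≤∣det∣ j = subst (∑ℕ (λ i → ℤ.∣ H i j ∣) ℕ.≤_) (sym ∣det∣≡∏diagₙ)
    (∑ℕ≤∏ℕ diagₙ (λ i → ℤ.∣ H i j ∣) j 1≤diagₙ ℕP.≤-refl (λ i i≢j → ∣H∣<diagₙ i j i≢j))

  ∑pred-diagₙ+1≤∣det∣ : ∑ℕ (λ i → diagₙ i ℕ.∸ 1) ℕ.+ 1 ℕ.≤ ℤ.∣ det H ∣
  ∑pred-diagₙ+1≤∣det∣ = subst (∑ℕ (λ i → diagₙ i ℕ.∸ 1) ℕ.+ 1 ℕ.≤_) (sym ∣det∣≡∏diagₙ) (∑pred+1≤∏ℕ diagₙ 1≤diagₙ)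

N2⇒1≤diag : ∀ {n} (H : Mat ℤ n n) c h c0 Δ → N2 H c h c0 Δ → ∀ i → + 1 ℤ.≤ H i i
N2⇒1≤diag H c h c0 Δ (s , _ , _ , _ , identity-block , _ , _ , 2≤T-diag) i with toℕ i ℕ.<? s
... | no i≮s = ℤP.≤-trans (ℤ.+≤+ (ℕ.s≤s ℕ.z≤n)) (2≤T-diag i (ℕP.≮⇒≥ i≮s))
... | yes i<s with toℕ i ℕ.≟ toℕ i | identity-block i i i<s
...   | yes _ | Hii≡1 = ℤP.≤-reflexive (sym Hii≡1)
...   | no i≢i | _ = ⊥-elim (i≢i refl)

module Multipliers {n : ℕ} (H : Mat ℤ n n) (c : Fin n → ℤ) (t : Fin n → ℚ)
  (c≡-Hᵀt : ∀ j → toℚ (c j) ≡ ℚ.- sumℚ (λ i → toℚ (H i j) ℚ.* t i)) where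

  c·x≡-t·Hx : ∀ x → dotℚ c x ≡ ℚ.- sumℚ (λ i → t i ℚ.* dotℚ (H i) x)
  c·x≡-t·Hx x = begin
      sumℚ (λ j → toℚ (c j) ℚ.* x j)
    ≡⟨ Σℚ.σ-cong (λ j → trans (cong (ℚ._* x j) (c≡-Hᵀt j)) (column j)) ⟩
      sumℚ (λ j → sumℚ (λ i → ℚ.- (t i ℚ.* (toℚ (H i j) ℚ.* x j))))
    ≡⟨ Σℚ.σ-comm (λ j i → ℚ.- (t i ℚ.* (toℚ (H i j) ℚ.* x j))) ⟩
      sumℚ (λ i → sumℚ (λ j → ℚ.- (t i ℚ.* (toℚ (H i j) ℚ.* x j))))
    ≡⟨ Σℚ.σ-cong (λ i → trans (Σℚ.σ-neg (λ j → t i ℚ.* (toℚ (H i j) ℚ.* x j)))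
                              (cong ℚ.-_ (Σℚ.σ-*ˡ (t i) (λ j → toℚ (H i j) ℚ.* x j)))) ⟩
      sumℚ (λ i → ℚ.- (t i ℚ.* dotℚ (H i) x))
    ≡⟨ Σℚ.σ-neg (λ i → t i ℚ.* dotℚ (H i) x) ⟩
      ℚ.- sumℚ (λ i → t i ℚ.* dotℚ (H i) x)
    ∎
    where
    open ≡-Reasoning
    open ℚSolver.+-*-Solver
    column : ∀ j → ℚ.- sumℚ (λ i → toℚ (H i j) ℚ.* t i) ℚ.* x j ≡ sumℚ (λ i → ℚ.- (t i ℚ.* (toℚ (H i j) ℚ.* x j)))
    column j = begin
        ℚ.- sumℚ (λ i → toℚ (H i j) ℚ.* t i) ℚ.* x j
      ≡⟨ solve 2 (λ s x → (:- s) :* x := :- (x :* s)) refl (sumℚ (λ i → toℚ (H i j) ℚ.* t i)) (x j) ⟩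
        ℚ.- (x j ℚ.* sumℚ (λ i → toℚ (H i j) ℚ.* t i))
      ≡⟨ cong ℚ.-_ (Σℚ.σ-*ˡ (x j) (λ i → toℚ (H i j) ℚ.* t i)) ⟨
        ℚ.- sumℚ (λ i → x j ℚ.* (toℚ (H i j) ℚ.* t i))
      ≡⟨ Σℚ.σ-neg (λ i → x j ℚ.* (toℚ (H i j) ℚ.* t i)) ⟨
        sumℚ (λ i → ℚ.- (x j ℚ.* (toℚ (H i j) ℚ.* t i)))
      ≡⟨ Σℚ.σ-cong (λ i → cong ℚ.-_ (solve 3 (λ x a t → x :* (a :* t) := t :* (a :* x)) refl (x j) (toℚ (H i j)) (t i))) ⟩
        sumℚ (λ i → ℚ.- (t i ℚ.* (toℚ (H i j) ℚ.* x j)))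
      ∎

  c·d≡tᵢ : ∀ i d → (∀ k → dotℚ (H k) d ≡ ℚ.- unitVec i k) → dotℚ c d ≡ t i
  c·d≡tᵢ i d Hd≡-eᵢ = begin
    dotℚ c d                                         ≡⟨ c·x≡-t·Hx d ⟩
    ℚ.- sumℚ (λ k → t k ℚ.* dotℚ (H k) d)            ≡⟨ cong ℚ.-_ (Σℚ.σ-cong (λ k → cong (t k ℚ.*_) (Hd≡-eᵢ k))) ⟩
    ℚ.- sumℚ (λ k → t k ℚ.* ℚ.- unitVec i k)         ≡⟨ cong ℚ.-_ (Σℚ.σ-cong (λ k → ℚP.neg-distribʳ-* (t k) _)) ⟨
    ℚ.- sumℚ (λ k → ℚ.- (t k ℚ.* unitVec i k))       ≡⟨ cong ℚ.-_ (Σℚ.σ-neg (λ k → t k ℚ.* unitVec i k)) ⟩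
    ℚ.- (ℚ.- sumℚ (λ k → t k ℚ.* unitVec i k))       ≡⟨ neg-involutive _ ⟩
    sumℚ (λ k → t k ℚ.* unitVec i k)                 ≡⟨ Σℚ.σ-cong (λ k → ℚP.*-comm (t k) (unitVec i k)) ⟩
    sumℚ (λ k → unitVec i k ℚ.* t k)                 ≡⟨ sumℚ-unitVec i t ⟩
    t i                                              ∎
    where open ≡-Reasoning

  -- If tᵢ ≤ 0, the direction d with H d = −eᵢ has c·d = tᵢ ≤ 0, so the whole ray x + L d
  -- from a point x of the simplex stays inside it.
  positive : ∀ h c0 (V : Fin (suc n) → Fin n → ℚ) → SimplexWithVertices (Asys H c h c0) (bsys H c h c0) V →
    (∀ i j → toℕ i ℕ.< toℕ j → H i j ≡ + 0) → (∀ i → H i i ≢ + 0) → ∀ i → 0ℚ ℚ.< t i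
  positive h c0 V simplex upper≡0 diag≢0 i with t i ℚ.≤? 0ℚ
  ... | no ti≰0 = ℚP.≰⇒> ti≰0
  ... | yes ti≤0 = ⊥-elim (-1≢0 (begin
    ℚ.- 1ℚ         ≡⟨ cong ℚ.-_ (unitVec-self i) ⟨
    ℚ.- unitVec i i ≡⟨ Hd≡-eᵢ i ⟨
    dotℚ (H i) d   ≡⟨ Σℚ.σ-cong (λ j → trans (cong (toℚ (H i j) ℚ.*_) (d≡0 j)) (ℚP.*-zeroʳ (toℚ (H i j)))) ⟩
    sumℚ {n} (λ _ → 0ℚ) ≡⟨ Σℚ.σ-zeros {n} ⟩
    0ℚ             ∎))
    where
    open ≡-Reasoning
    open SimplexGeometry (Asys H c h c0) (bsys H c h c0) V simplex
    -1≢0 : ℚ.- 1ℚ ≢ 0ℚ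
    -1≢0 ()
    solution : Σ (Fin n → ℚ) λ d → ∀ k → sumℚ (λ j → toℚ (H k j) ℚ.* d j) ≡ ℚ.- unitVec i k
    solution = solve-lowerTriangular (λ k j → toℚ (H k j)) (λ k j k<j → cong toℚ (upper≡0 k j k<j))
      (λ k Hkk≡0 → diag≢0 k (toℚ-injective Hkk≡0)) (λ k → ℚ.- unitVec i k)
    d : Fin n → ℚ
    d = proj₁ solution
    Hd≡-eᵢ : ∀ k → dotℚ (H k) d ≡ ℚ.- unitVec i k
    Hd≡-eᵢ = proj₂ solution
    x : Fin n → ℚ
    x = V zero
    x∈S : (∀ k → dotℚ (H k) x ℚ.≤ toℚ (h k)) × (dotℚ c x ℚ.≤ toℚ c0)
    x∈S = InS⇒split H c h c0 x (vertex∈S zero)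
    ray⊆S : ∀ L → 0ℚ ℚ.≤ L → InS (Asys H c h c0) (bsys H c h c0) (λ j → x j ℚ.+ L ℚ.* d j)
    ray⊆S L 0≤L = split⇒InS H c h c0 (λ j → x j ℚ.+ L ℚ.* d j)
      (λ k → subst (ℚ._≤ toℚ (h k)) (sym (trans (dotℚ-linear (H k) x d L) (cong (λ y → dotℚ (H k) x ℚ.+ L ℚ.* y) (Hd≡-eᵢ k))))
                   (ℚP.≤-trans (x+nonPos≤x (nonNeg*nonPos≤0 0≤L (ℚP.neg-antimono-≤ (unitVec-nonNeg i k)))) (proj₁ x∈S k)))
      (subst (ℚ._≤ toℚ c0) (sym (trans (dotℚ-linear c x d L) (cong (λ y → dotℚ c x ℚ.+ L ℚ.* y) (c·d≡tᵢ i d Hd≡-eᵢ))))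
             (ℚP.≤-trans (x+nonPos≤x (nonNeg*nonPos≤0 0≤L ti≤0)) (proj₂ x∈S)))
    d≡0 : ∀ j → d j ≡ 0ℚ
    d≡0 = ray⊆S⇒direction≡0 x d ray⊆S

  ∣c∣≤columnSum : (∀ i j → + 0 ℤ.≤ H i j) → (∀ i → 0ℚ ℚ.≤ t i) → (∀ i → t i ℚ.≤ 1ℚ) →
    ∀ j → ℤ.∣ c j ∣ ℕ.≤ ∑ℕ (λ i → ℤ.∣ H i j ∣)
  ∣c∣≤columnSum 0≤H 0≤t t≤1 j = subst (ℕ._≤ ∑ℕ (λ i → ℤ.∣ H i j ∣)) (ℤP.∣-i∣≡∣i∣ (c j))
    (0≤x≤+n⇒∣x∣≤n {ℤ.- c j} (toℚ-cancel-≤ 0≤-c) (toℚ-cancel-≤ -c≤colsum))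
    where
    0≤Ht : ∀ i → 0ℚ ℚ.≤ toℚ (H i j) ℚ.* t i
    0≤Ht i = 0≤x*y (toℚ-mono-≤ (0≤H i j)) (0≤t i)
    -c≡Σ : toℚ (ℤ.- c j) ≡ sumℚ (λ i → toℚ (H i j) ℚ.* t i)
    -c≡Σ = trans (toℚ-neg (c j)) (trans (cong ℚ.-_ (c≡-Hᵀt j)) (neg-involutive _))
    0≤-c : toℚ (+ 0) ℚ.≤ toℚ (ℤ.- c j)
    0≤-c = subst (0ℚ ℚ.≤_) (sym -c≡Σ) (sumℚ-nonNeg 0≤Ht)
    -c≤colsum : toℚ (ℤ.- c j) ℚ.≤ toℚ (+ ∑ℕ (λ i → ℤ.∣ H i j ∣))
    -c≤colsum = begin
      toℚ (ℤ.- c j)                        ≡⟨ -c≡Σ ⟩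
      sumℚ (λ i → toℚ (H i j) ℚ.* t i)     ≤⟨ sumℚ-mono-≤ (λ i → ℚP.*-monoˡ-≤-nonNeg (toℚ (H i j))
                                                {{ℚ.nonNegative (toℚ-mono-≤ (0≤H i j))}} (t≤1 i)) ⟩
      sumℚ (λ i → toℚ (H i j) ℚ.* 1ℚ)      ≡⟨ Σℚ.σ-cong (λ i → ℚP.*-identityʳ (toℚ (H i j))) ⟩
      sumℚ (λ i → toℚ (H i j))             ≡⟨ toℚ-sumℤ (λ i → H i j) ⟨
      toℚ (sumℤ (λ i → H i j))             ≡⟨ cong toℚ (sumℤ-nonNeg≡+∑ℕ∣∣ (λ i → H i j) (λ i → 0≤H i j)) ⟩
      toℚ (+ ∑ℕ (λ i → ℤ.∣ H i j ∣))       ∎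
      where open ℚP.≤-Reasoning

module _ (Δ : ℕ) {n : ℕ} (H : Mat ℤ n n) (c h : Fin n → ℤ) (c0 : ℤ)
  (hnf : IsHNF H) (∣det∣≡ΔA : ℤ.∣ det H ∣ ≡ ΔA (Asys H c h c0)) (ΔA≤Δ : ΔA (Asys H c h c0) ℕ.≤ Δ)
  (1≤diag : ∀ i → + 1 ℤ.≤ H i i) where

  open HermiteBounds H hnf 1≤diag

  ∣det∣≤Δ : ℤ.∣ det H ∣ ℕ.≤ Δ
  ∣det∣≤Δ = subst (ℕ._≤ Δ) (sym ∣det∣≡ΔA) ΔA≤Δ

  multipliers : Σ (Fin n → ℚ) λ t → ∀ j → toℚ (c j) ≡ ℚ.- sumℚ (λ i → toℚ (H i j) ℚ.* t i)
  multipliers with solve-transposed-lowerTriangular (λ i j → toℚ (H i j)) (λ i j i<j → cong toℚ (upper≡0 i j i<j))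
                     (λ i Hii≡0 → ℚP.<-irrefl (sym Hii≡0) (ℚP.<-≤-trans (ℚP.positive⁻¹ 1ℚ) (toℚ-mono-≤ (1≤diag i))))
                     (λ j → ℚ.- toℚ (c j))
  ... | t , Hᵀt≡-c = t , λ j → trans (sym (neg-involutive (toℚ (c j)))) (cong ℚ.-_ (sym (Hᵀt≡-c j)))

  N5∧N6 : ∀ V → SimplexWithVertices (Asys H c h c0) (bsys H c h c0) V → N5 H c h c0 × N6 H c h c0 Δ
  N5∧N6 V simplex = (t , (λ i → 0<t i , t≤1 i) , c≡-Hᵀt) , entries≤Δ
    where
    t : Fin n → ℚ
    t = proj₁ multipliers
    c≡-Hᵀt : ∀ j → toℚ (c j) ≡ ℚ.- sumℚ (λ i → toℚ (H i j) ℚ.* t i)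
    c≡-Hᵀt = proj₂ multipliers
    open Multipliers H c t c≡-Hᵀt
    0<t : ∀ i → 0ℚ ℚ.< t i
    0<t = positive h c0 V simplex upper≡0 (λ i Hii≡0 → ℤP.<-irrefl (sym Hii≡0) (ℤP.<-≤-trans (ℤ.+<+ (ℕ.s≤s ℕ.z≤n)) (1≤diag i)))
    t≤1 : ∀ i → t i ℚ.≤ 1ℚ
    t≤1 i = ℚP.≤-trans (p≤∣p∣ (t i)) (∣multipliers∣≤1 H c t c≡-Hᵀt 0<∣det∣
      (λ i′ → subst (ℤ.∣ det (stackWithout H c i′) ∣ ℕ.≤_) (sym ∣det∣≡ΔA)
                 (maxℕ-ub (λ i → ℤ.∣ det (λ r s → Asys H c h c0 (punchIn i r) s) ∣) (inject₁ i′))) i)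
    entries≤Δ : N6 H c h c0 Δ
    entries≤Δ i j with fromℕ-or-inject₁ i
    ... | inj₁ refl = subst (λ row → ℤ.∣ row j ∣ ℕ.≤ Δ) (sym (stack-fromℕ H c))
      (ℕP.≤-trans (∣c∣≤columnSum 0≤H (ℚP.<⇒≤ ∘ 0<t) t≤1 j) (ℕP.≤-trans (columnSum≤∣det∣ j) ∣det∣≤Δ))
    ... | inj₂ (k , refl) = subst (λ row → ℤ.∣ row j ∣ ℕ.≤ Δ) (sym (stack-inject₁ H c k))
      (ℕP.≤-trans (∣H∣≤∣det∣ k j) ∣det∣≤Δ)

-- Distance between c₀ and the opposite vertex

gcdRow-zeroRow : ∀ {n} (a : Fin n → ℤ) a0 → (∀ j → a j ≡ + 0) → gcdRow a a0 ≡ ℤ.∣ a0 ∣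
gcdRow-zeroRow {zero} a a0 a≡0 = refl
gcdRow-zeroRow {suc n} a a0 a≡0 rewrite a≡0 zero = trans (GCD.gcd-identityˡ _) (gcdRow-zeroRow (a ∘ suc) a0 (a≡0 ∘ suc))

Fin-inhabited? : ∀ n → Fin n ⊎ ¬ Fin n
Fin-inhabited? zero = inj₂ (λ ())
Fin-inhabited? (suc n) = inj₁ zero

module FacetDistance (Δ : ℕ) (1≤Δ : 1 ℕ.≤ Δ) {n : ℕ} (H : Mat ℤ n n) (c h : Fin n → ℤ) (c0 : ℤ)
  (hnf : IsHNF H) (1≤diag : ∀ i → + 1 ℤ.≤ H i i) (∣det∣≤Δ : ℤ.∣ det H ∣ ℕ.≤ Δ)
  (n3 : N3 H c h c0) (n4 : N4 H c h c0) (n5 : N5 H c h c0) (n6 : N6 H c h c0 Δ)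
  (V : Fin (suc n) → Fin n → ℚ) (simplex : SimplexWithVertices (Asys H c h c0) (bsys H c h c0) V)
  (v : Fin n → ℚ) (Hv≡h : ∀ i → dotℚ (H i) v ≡ toℚ (h i)) where

  open HermiteBounds H hnf 1≤diag
  open SimplexGeometry (Asys H c h c0) (bsys H c h c0) V simplex

  _∈S : (Fin n → ℚ) → Set
  x ∈S = InS (Asys H c h c0) (bsys H c h c0) x

  ∈S-cong : ∀ {x y} → (∀ j → x j ≡ y j) → x ∈S → y ∈S
  ∈S-cong = InS-cong (Asys H c h c0) (bsys H c h c0)

  t : Fin n → ℚ
  t = proj₁ n5
  0≤t : ∀ i → 0ℚ ℚ.≤ t i
  0≤t i = ℚP.<⇒≤ (proj₁ (proj₁ (proj₂ n5) i))
  t≤1 : ∀ i → t i ℚ.≤ 1ℚ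
  t≤1 i = proj₂ (proj₁ (proj₂ n5) i)

  open Multipliers H c t (proj₂ (proj₂ n5))

  Δq : ℚ
  Δq = toℚ (+ Δ)

  0≤h : ∀ i → 0ℚ ℚ.≤ toℚ (h i)
  0≤h i = toℚ-mono-≤ (proj₁ (n3 i))

  T : ℚ
  T = sumℚ (λ i → t i ℚ.* toℚ (h i))

  0≤T : 0ℚ ℚ.≤ T
  0≤T = sumℚ-nonNeg (λ i → 0≤x*y (0≤t i) (0≤h i))

  T+1≤Δ : T ℚ.+ 1ℚ ℚ.≤ Δq
  T+1≤Δ = begin
    T ℚ.+ 1ℚ                                             ≤⟨ ℚP.+-monoˡ-≤ 1ℚ (sumℚ-mono-≤ (λ i →
                                                              ℚP.≤-trans (ℚP.*-monoʳ-≤-nonNeg (toℚ (h i)) {{ℚ.nonNegative (0≤h i)}} (t≤1 i))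
                                                                         (ℚP.≤-reflexive (ℚP.*-identityˡ _)))) ⟩
    sumℚ (λ i → toℚ (h i)) ℚ.+ 1ℚ                        ≡⟨ cong (ℚ._+ 1ℚ) (trans (sym (toℚ-sumℤ h))
                                                              (cong toℚ (sumℤ-nonNeg≡+∑ℕ∣∣ h (proj₁ ∘ n3)))) ⟩
    toℚ (+ ∑ℕ (λ i → ℤ.∣ h i ∣)) ℚ.+ toℚ (+ 1)           ≡⟨ toℚ-+ (+ ∑ℕ (λ i → ℤ.∣ h i ∣)) (+ 1) ⟨
    toℚ (+ (∑ℕ (λ i → ℤ.∣ h i ∣) ℕ.+ 1))                 ≤⟨ toℚ-mono-≤ (ℤ.+≤+ (ℕP.≤-trans (ℕP.+-monoˡ-≤ 1 ∑h≤∑pred-diagₙ)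
                                                              (ℕP.≤-trans ∑pred-diagₙ+1≤∣det∣ ∣det∣≤Δ))) ⟩
    Δq                                                   ∎
    where
    open ℚP.≤-Reasoning
    ∑h≤∑pred-diagₙ : ∑ℕ (λ i → ℤ.∣ h i ∣) ℕ.≤ ∑ℕ (λ i → diagₙ i ℕ.∸ 1)
    ∑h≤∑pred-diagₙ = ∑ℕ-mono-≤ (λ i → ℕP.∸-monoˡ-≤ 1 (h<diagₙ i))
      where
      h<diagₙ : ∀ i → ℤ.∣ h i ∣ ℕ.< diagₙ i
      h<diagₙ i with h i | H i i | n3 i
      ... | + _ | + _ | _ , ℤ.+<+ hi<Hii = hi<Hii

  gap : ℚ
  gap = toℚ c0 ℚ.- dotℚ c v

  c·v≡-T : dotℚ c v ≡ ℚ.- T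
  c·v≡-T = trans (c·x≡-t·Hx v) (cong ℚ.-_ (Σℚ.σ-cong (λ i → cong (t i ℚ.*_) (Hv≡h i))))

  gap≡c0+T : gap ≡ toℚ c0 ℚ.+ T
  gap≡c0+T = cong (toℚ c0 ℚ.+_) (trans (cong ℚ.-_ c·v≡-T) (neg-involutive T))

  0≤gap : 0ℚ ℚ.≤ gap
  0≤gap = subst (0ℚ ℚ.≤_) (sym gap≡c0+T) (begin
    0ℚ                    ≡⟨ ℚP.+-inverseˡ T ⟨
    ℚ.- T ℚ.+ T           ≤⟨ ℚP.+-monoˡ-≤ T (ℚP.≤-trans -T≤c·x (proj₂ x∈S)) ⟩
    toℚ c0 ℚ.+ T          ∎)
    where
    open ℚP.≤-Reasoning
    x∈S : (∀ k → dotℚ (H k) (V zero) ℚ.≤ toℚ (h k)) × (dotℚ c (V zero) ℚ.≤ toℚ c0)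
    x∈S = InS⇒split H c h c0 (V zero) (vertex∈S zero)
    -T≤c·x : ℚ.- T ℚ.≤ dotℚ c (V zero)
    -T≤c·x = subst (ℚ.- T ℚ.≤_) (sym (c·x≡-t·Hx (V zero)))
      (ℚP.neg-antimono-≤ (sumℚ-mono-≤ (λ i → ℚP.*-monoˡ-≤-nonNeg (t i) {{ℚ.nonNegative (0≤t i)}} (proj₁ x∈S i))))

  -- A gap beyond Δ forces c₀ > 1, so the origin lies in S; integer points of S are then shown
  -- not to be vertices by segments in direction v or eₗ, of length ε = 1/Δ.
  module _ (Δ<gap : Δq ℚ.< gap) where

    instance
      Δq>0 : ℚ.Positive Δq
      Δq>0 = ℚ.positive (toℚ-mono-< (ℤ.+<+ 1≤Δ))
      Δq≢0 : ℚ.NonZero Δq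
      Δq≢0 = ℚP.pos⇒nonZero Δq

    ε : ℚ
    ε = ℚ.1/ Δq

    0≤ε : 0ℚ ℚ.≤ ε
    0≤ε = ℚP.<⇒≤ (ℚP.positive⁻¹ ε {{ℚP.1/pos⇒pos Δq}})

    ε*Δ≡1 : ε ℚ.* Δq ≡ 1ℚ
    ε*Δ≡1 = ℚP.*-inverseˡ Δq

    1≤Δq : 1ℚ ℚ.≤ Δq
    1≤Δq = toℚ-mono-≤ (ℤ.+≤+ 1≤Δ)

    1≤1+ε : 1ℚ ℚ.≤ 1ℚ ℚ.+ ε
    1≤1+ε = ℚP.≤-trans (ℚP.≤-reflexive (sym (ℚP.+-identityʳ 1ℚ))) (ℚP.+-monoʳ-≤ 1ℚ 0≤ε)

    ε≤1 : ε ℚ.≤ 1ℚ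
    ε≤1 = subst₂ ℚ._≤_ (ℚP.*-identityʳ ε) ε*Δ≡1 (ℚP.*-monoˡ-≤-nonNeg ε {{ℚ.nonNegative 0≤ε}} 1≤Δq)

    εx≡0⇒x≡0 : ∀ x → ε ℚ.* x ≡ 0ℚ → x ≡ 0ℚ
    εx≡0⇒x≡0 x εx≡0 = begin
      x                    ≡⟨ ℚP.*-identityˡ x ⟨
      1ℚ ℚ.* x             ≡⟨ cong (ℚ._* x) ε*Δ≡1 ⟨
      (ε ℚ.* Δq) ℚ.* x     ≡⟨ solve 3 (λ e d x → (e :* d) :* x := d :* (e :* x)) refl ε Δq x ⟩
      Δq ℚ.* (ε ℚ.* x)     ≡⟨ cong (Δq ℚ.*_) εx≡0 ⟩
      Δq ℚ.* 0ℚ            ≡⟨ ℚP.*-zeroʳ Δq ⟩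
      0ℚ                   ∎
      where
      open ≡-Reasoning
      open ℚSolver.+-*-Solver

    1<c0 : 1ℚ ℚ.< toℚ c0
    1<c0 = +-cancelʳ-< T (begin-strict
      1ℚ ℚ.+ T          ≡⟨ ℚP.+-comm 1ℚ T ⟩
      T ℚ.+ 1ℚ          ≤⟨ T+1≤Δ ⟩
      Δq                <⟨ Δ<gap ⟩
      gap               ≡⟨ gap≡c0+T ⟩
      toℚ c0 ℚ.+ T      ∎)
      where open ℚP.≤-Reasoning

    0≤c0 : 0ℚ ℚ.≤ toℚ c0
    0≤c0 = ℚP.<⇒≤ (ℚP.<-trans (ℚP.positive⁻¹ 1ℚ) 1<c0)

    εT≤1 : ε ℚ.* T ℚ.≤ 1ℚ
    εT≤1 = subst (ε ℚ.* T ℚ.≤_) ε*Δ≡1 (ℚP.*-monoˡ-≤-nonNeg ε {{ℚ.nonNegative 0≤ε}}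
             (ℚP.≤-trans (ℚP.<⇒≤ (p<p+1 T)) T+1≤Δ))

    scaled∈S : ∀ L (y : Fin n → ℚ) → (∀ k → L ℚ.* dotℚ (H k) y ℚ.≤ toℚ (h k)) → L ℚ.* dotℚ c y ℚ.≤ toℚ c0 →
      (λ j → L ℚ.* y j) ∈S
    scaled∈S L y LHy≤h Lcy≤c0 = split⇒InS H c h c0 (λ j → L ℚ.* y j)
      (λ k → subst (ℚ._≤ toℚ (h k)) (sym (dotℚ-scale (H k) L y)) (LHy≤h k))
      (subst (ℚ._≤ toℚ c0) (sym (dotℚ-scale c L y)) Lcy≤c0)

    origin∈S : (λ _ → toℚ (+ 0)) ∈S
    origin∈S = ∈S-cong (λ j → ℚP.*-zeroˡ 0ℚ)
      (scaled∈S 0ℚ (λ _ → 0ℚ) (λ k → subst (ℚ._≤ toℚ (h k)) (sym (ℚP.*-zeroˡ (dotℚ (H k) (λ _ → 0ℚ)))) (0≤h k))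
                             (subst (ℚ._≤ toℚ c0) (sym (ℚP.*-zeroˡ (dotℚ c (λ _ → 0ℚ)))) 0≤c0))

    OnlyVertices : Set
    OnlyVertices = ∀ z → IntIn (Asys H c h c0) (bsys H c h c0) z → ∃ λ i → (λ j → toℚ (z j)) ≡ V i

    εv∈S : (λ j → ε ℚ.* v j) ∈S
    εv∈S = scaled∈S ε v
      (λ k → subst (λ x → ε ℚ.* x ℚ.≤ toℚ (h k)) (sym (Hv≡h k))
               (ℚP.≤-trans (ℚP.*-monoʳ-≤-nonNeg (toℚ (h k)) {{ℚ.nonNegative (0≤h k)}} ε≤1)
                           (ℚP.≤-reflexive (ℚP.*-identityˡ _))))
      (subst (λ x → ε ℚ.* x ℚ.≤ toℚ c0) (sym c·v≡-T)
             (ℚP.≤-trans (nonNeg*nonPos≤0 0≤ε (ℚP.neg-antimono-≤ 0≤T)) 0≤c0))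

    -εv∈S : (λ j → ℚ.- ε ℚ.* v j) ∈S
    -εv∈S = scaled∈S (ℚ.- ε) v
      (λ k → subst (λ x → ℚ.- ε ℚ.* x ℚ.≤ toℚ (h k)) (sym (Hv≡h k))
               (ℚP.≤-trans (subst (ℚ._≤ 0ℚ) (ℚP.neg-distribˡ-* ε (toℚ (h k)))
                                  (ℚP.neg-antimono-≤ (0≤x*y 0≤ε (0≤h k))))
                           (0≤h k)))
      (subst (λ x → ℚ.- ε ℚ.* x ℚ.≤ toℚ c0) (sym c·v≡-T)
             (subst (ℚ._≤ toℚ c0) (sym (trans (sym (ℚP.neg-distribˡ-* ε (ℚ.- T)))
                                              (trans (cong ℚ.-_ (sym (ℚP.neg-distribʳ-* ε T))) (neg-involutive _))))
                    (ℚP.<⇒≤ (ℚP.≤-<-trans εT≤1 1<c0))))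

    -- h ≢ 0: the origin is a vertex V i, but V i ± ε v ∈ S with v ≢ 0.
    h≢0⇒⊥ : (∃ λ k → h k ≢ + 0) → OnlyVertices → ⊥
    h≢0⇒⊥ (k , hk≢0) onlyVertices = hk≢0 (toℚ-injective (begin
      toℚ (h k)             ≡⟨ Hv≡h k ⟨
      dotℚ (H k) v          ≡⟨ Σℚ.σ-cong (λ j → trans (cong (toℚ (H k j) ℚ.*_) (v≡0 j)) (ℚP.*-zeroʳ (toℚ (H k j)))) ⟩
      sumℚ {n} (λ _ → 0ℚ)   ≡⟨ Σℚ.σ-zeros {n} ⟩
      0ℚ                    ∎))
      where
      open ≡-Reasoning
      origin-vertex : ∃ λ i → (λ j → toℚ (+ 0)) ≡ V i
      origin-vertex = onlyVertices (λ _ → + 0) origin∈S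
      i : Fin (suc n)
      i = proj₁ origin-vertex
      Vi≡0 : ∀ j → V i j ≡ 0ℚ
      Vi≡0 j = sym (cong-app (proj₂ origin-vertex) j)
      Vi+εv∈S : (λ j → V i j ℚ.+ ε ℚ.* v j) ∈S
      Vi+εv∈S = ∈S-cong (λ j → trans (sym (ℚP.+-identityˡ _)) (cong (ℚ._+ ε ℚ.* v j) (sym (Vi≡0 j)))) εv∈S
      Vi-εv∈S : (λ j → V i j ℚ.- ε ℚ.* v j) ∈S
      Vi-εv∈S = ∈S-cong (λ j → trans (sym (ℚP.neg-distribˡ-* ε (v j)))
                                (trans (sym (ℚP.+-identityˡ _)) (cong (ℚ._- ε ℚ.* v j) (sym (Vi≡0 j))))) -εv∈S
      v≡0 : ∀ j → v j ≡ 0ℚ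
      v≡0 j = εx≡0⇒x≡0 (v j) (vertex-extreme i (λ j → ε ℚ.* v j) Vi+εv∈S Vi-εv∈S j)

    module _ (h≡0 : ∀ k → h k ≡ + 0) where

      Δ<c0 : + Δ ℤ.< c0
      Δ<c0 = toℚ-cancel-< (subst (Δq ℚ.<_) (trans gap≡c0+T (trans (cong (toℚ c0 ℚ.+_) T≡0) (ℚP.+-identityʳ _))) Δ<gap)
        where
        T≡0 : T ≡ 0ℚ
        T≡0 = trans (Σℚ.σ-cong (λ i → trans (cong (λ x → t i ℚ.* toℚ x) (h≡0 i)) (ℚP.*-zeroʳ (t i)))) (Σℚ.σ-zeros {n})

      Δ+1≤c0 : Δq ℚ.+ 1ℚ ℚ.≤ toℚ c0
      Δ+1≤c0 = subst (ℚ._≤ toℚ c0) (toℚ-+ (+ Δ) (+ 1))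
        (toℚ-mono-≤ (subst (ℤ._≤ c0) (trans (cong +_ (ℕP.+-comm 1 Δ)) (ℤP.pos-+ Δ 1)) (ℤP.i<j⇒suc[i]≤j Δ<c0)))

      -cₗ≤Δ : ∀ l → ℚ.- toℚ (c l) ℚ.≤ Δq
      -cₗ≤Δ l = subst (ℚ._≤ Δq) (toℚ-neg (c l)) (toℚ-mono-≤ (ℤP.≤-trans (i≤+∣i∣ (ℤ.- c l))
                  (ℤ.+≤+ (subst (ℕ._≤ Δ) (sym (ℤP.∣-i∣≡∣i∣ (c l)))
                    (subst (λ row → ℤ.∣ row l ∣ ℕ.≤ Δ) (stack-fromℕ H c) (n6 (fromℕ n) l))))))

      scaled-negUnit∈S : ∀ l L → 0ℚ ℚ.≤ L → L ℚ.≤ 1ℚ ℚ.+ ε → (λ j → L ℚ.* ℚ.- unitVec l j) ∈S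
      scaled-negUnit∈S l L 0≤L L≤1+ε = scaled∈S L (λ j → ℚ.- unitVec l j)
        (λ k → subst₂ (λ x y → L ℚ.* x ℚ.≤ y) (sym (dotℚ-negUnit (H k) l)) (cong toℚ (sym (h≡0 k)))
                 (nonNeg*nonPos≤0 0≤L (ℚP.neg-antimono-≤ (toℚ-mono-≤ (0≤H k l)))))
        (subst (λ x → L ℚ.* x ℚ.≤ toℚ c0) (sym (dotℚ-negUnit c l)) (begin
          L ℚ.* ℚ.- toℚ (c l)      ≤⟨ ℚP.*-monoˡ-≤-nonNeg L {{ℚ.nonNegative 0≤L}} (-cₗ≤Δ l) ⟩
          L ℚ.* Δq                 ≤⟨ ℚP.*-monoʳ-≤-nonNeg Δq {{ℚ.nonNegative (ℚP.<⇒≤ (ℚP.positive⁻¹ Δq))}} L≤1+ε ⟩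
          (1ℚ ℚ.+ ε) ℚ.* Δq        ≡⟨ trans (ℚP.*-distribʳ-+ Δq 1ℚ ε) (cong₂ ℚ._+_ (ℚP.*-identityˡ Δq) ε*Δ≡1) ⟩
          Δq ℚ.+ 1ℚ                ≤⟨ Δ+1≤c0 ⟩
          toℚ c0                   ∎))
        where open ℚP.≤-Reasoning

      -- The integer point −eₗ lies in S, hence is a vertex, but so do (1 ± ε)(−eₗ).
      coordinate⇒⊥ : OnlyVertices → Fin n → ⊥
      coordinate⇒⊥ onlyVertices l = pₗ≢0 (εx≡0⇒x≡0 (p l)
        (vertex-extreme i (λ j → ε ℚ.* p j) (at-vertex (1ℚ ℚ.+ ε) +ε-shape 0≤1+ε ℚP.≤-refl)
                                            (at-vertex (1ℚ ℚ.- ε) -ε-shape 0≤1-ε 1-ε≤1+ε) l))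
        where
        open ℚSolver.+-*-Solver
        p : Fin n → ℚ
        p j = ℚ.- unitVec l j
        pₗ≢0 : p l ≢ 0ℚ
        pₗ≢0 pₗ≡0 = -1≢0 (trans (cong ℚ.-_ (sym (unitVec-self l))) pₗ≡0)
          where
          -1≢0 : ℚ.- 1ℚ ≢ 0ℚ
          -1≢0 ()
        0≤1+ε : 0ℚ ℚ.≤ 1ℚ ℚ.+ ε
        0≤1+ε = ℚP.≤-trans (ℚP.<⇒≤ (ℚP.positive⁻¹ 1ℚ)) 1≤1+ε
        0≤1-ε : 0ℚ ℚ.≤ 1ℚ ℚ.- ε
        0≤1-ε = subst (ℚ._≤ 1ℚ ℚ.- ε) (ℚP.+-inverseʳ ε) (ℚP.+-monoˡ-≤ (ℚ.- ε) ε≤1)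
        1-ε≤1+ε : 1ℚ ℚ.- ε ℚ.≤ 1ℚ ℚ.+ ε
        1-ε≤1+ε = ℚP.+-monoʳ-≤ 1ℚ (ℚP.≤-trans (ℚP.neg-antimono-≤ 0≤ε) 0≤ε)
        p-vertex : ∃ λ i → (λ j → toℚ (negUnitℤ l j)) ≡ V i
        p-vertex = onlyVertices (negUnitℤ l) (∈S-cong (λ j → trans (ℚP.*-identityˡ (p j)) (sym (toℚ-negUnitℤ l j)))
          (scaled-negUnit∈S l 1ℚ (ℚP.<⇒≤ (ℚP.positive⁻¹ 1ℚ)) 1≤1+ε))
        i : Fin (suc n)
        i = proj₁ p-vertex
        Vi≡p : ∀ j → V i j ≡ p j
        Vi≡p j = trans (sym (cong-app (proj₂ p-vertex) j)) (toℚ-negUnitℤ l j)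
        at-vertex : ∀ L {w : Fin n → ℚ} → (∀ j → L ℚ.* p j ≡ p j ℚ.+ w j) →
          0ℚ ℚ.≤ L → L ℚ.≤ 1ℚ ℚ.+ ε → (λ j → V i j ℚ.+ w j) ∈S
        at-vertex L Lp≡ 0≤L L≤1+ε =
          ∈S-cong (λ j → trans (Lp≡ j) (cong (ℚ._+ _) (sym (Vi≡p j)))) (scaled-negUnit∈S l L 0≤L L≤1+ε)
        +ε-shape : ∀ j → (1ℚ ℚ.+ ε) ℚ.* p j ≡ p j ℚ.+ ε ℚ.* p j
        +ε-shape j = solve 2 (λ e p → (con 1ℚ :+ e) :* p := p :+ e :* p) refl ε (p j)
        -ε-shape : ∀ j → (1ℚ ℚ.- ε) ℚ.* p j ≡ p j ℚ.+ ℚ.- (ε ℚ.* p j)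
        -ε-shape j = solve 2 (λ e p → (con 1ℚ :- e) :* p := p :+ (:- (e :* p))) refl ε (p j)

      -- Without coordinates, N4 reads ∣c₀∣ = 1.
      no-coordinates⇒⊥ : ¬ Fin n → ⊥
      no-coordinates⇒⊥ no-coordinates = ℤP.<-irrefl refl (ℤP.<-≤-trans Δ<c0 (ℤP.≤-trans (i≤+∣i∣ c0)
        (subst (λ x → + x ℤ.≤ + Δ) (sym ∣c0∣≡1) (ℤ.+≤+ 1≤Δ))))
        where
        ∣c0∣≡1 : ℤ.∣ c0 ∣ ≡ 1
        ∣c0∣≡1 = trans (sym (gcdRow-zeroRow c c0 (⊥-elim ∘ no-coordinates)))
                       (subst₂ (λ a b → gcdRow a b ≡ 1) (stack-fromℕ H c) (stack-fromℕ h c0) (n4 (fromℕ n)))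

    h≡0⇒⊥ : (∀ k → h k ≡ + 0) → OnlyVertices → ⊥
    h≡0⇒⊥ h≡0 onlyVertices with Fin-inhabited? n
    ... | inj₁ l = coordinate⇒⊥ h≡0 onlyVertices l
    ... | inj₂ no-coordinates = no-coordinates⇒⊥ h≡0 no-coordinates

    empty-or-lattice⇒⊥ : EmptyOrEmptyLattice (Asys H c h c0) (bsys H c h c0) V → ⊥
    empty-or-lattice⇒⊥ (inj₁ no-integer-points) = no-integer-points (λ _ → + 0) origin∈S
    empty-or-lattice⇒⊥ (inj₂ (_ , onlyVertices)) with FinP.all? (λ k → h k ℤ.≟ + 0)
    ... | yes h≡0 = h≡0⇒⊥ h≡0 onlyVertices
    ... | no h≢0 = h≢0⇒⊥ (FinP.¬∀⟶∃¬ n (λ k → h k ≡ + 0) (λ k → h k ℤ.≟ + 0) h≢0) onlyVertices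

  ∣gap∣≤Δ : EmptyOrEmptyLattice (Asys H c h c0) (bsys H c h c0) V → ℚ.∣ gap ∣ ℚ.≤ Δq
  ∣gap∣≤Δ empty with gap ℚ.≤? Δq
  ... | yes gap≤Δ = subst (ℚ._≤ Δq) (sym (ℚP.0≤p⇒∣p∣≡p 0≤gap)) gap≤Δ
  ... | no gap≰Δ = ⊥-elim (empty-or-lattice⇒⊥ (ℚP.≰⇒> gap≰Δ) empty)

lemma1 : (Δ : ℕ) → 1 ≤ Δ → (n : ℕ) (H : Mat ℤ n n) (c : Fin n → ℤ) (h : Fin n → ℤ) (c0 : ℤ)
  → IsSimplex (Asys H c h c0) (bsys H c h c0)
  → ΔA (Asys H c h c0) ≤ Δ
  → ((N1 H c h c0 × N2 H c h c0 Δ × N3 H c h c0 × N4 H c h c0) → N5 H c h c0 × N6 H c h c0 Δ)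
  × ((N1 H c h c0 × N2 H c h c0 Δ × N3 H c h c0 × N4 H c h c0 × N5 H c h c0 × N6 H c h c0 Δ)
     → (V : Fin (suc n) → Fin n → ℚ)
     → SimplexWithVertices (Asys H c h c0) (bsys H c h c0) V
     → EmptyOrEmptyLattice (Asys H c h c0) (bsys H c h c0) V
     → (v : Fin n → ℚ) → (∀ i → dotℚ (H i) v ≡ toℚ (h i))
     → ℚ.∣ toℚ c0 ℚ.- dotℚ c v ∣ ℚ.≤ toℚ (+ Δ))
lemma1 Δ 1≤Δ n H c h c0 (V , simplex) ΔA≤Δ = part₁ , part₂
  where
  part₁ : N1 H c h c0 × N2 H c h c0 Δ × N3 H c h c0 × N4 H c h c0 → N5 H c h c0 × N6 H c h c0 Δ
  part₁ ((hnf , ∣det∣≡ΔA) , n2 , _) = N5∧N6 Δ H c h c0 hnf ∣det∣≡ΔA ΔA≤Δ (N2⇒1≤diag H c h c0 Δ n2) V simplex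
  part₂ : N1 H c h c0 × N2 H c h c0 Δ × N3 H c h c0 × N4 H c h c0 × N5 H c h c0 × N6 H c h c0 Δ
    → (V : Fin (suc n) → Fin n → ℚ) → SimplexWithVertices (Asys H c h c0) (bsys H c h c0) V
    → EmptyOrEmptyLattice (Asys H c h c0) (bsys H c h c0) V
    → (v : Fin n → ℚ) → (∀ i → dotℚ (H i) v ≡ toℚ (h i))
    → ℚ.∣ toℚ c0 ℚ.- dotℚ c v ∣ ℚ.≤ toℚ (+ Δ)
  part₂ ((hnf , ∣det∣≡ΔA) , n2 , n3 , n4 , n5 , n6) V′ simplex′ empty v Hv≡h =
    FacetDistance.∣gap∣≤Δ Δ 1≤Δ H c h c0 hnf (N2⇒1≤diag H c h c0 Δ n2) (subst (_≤ Δ) (sym ∣det∣≡ΔA) ΔA≤Δ)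
      n3 n4 n5 n6 V′ simplex′ v Hv≡h empty
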